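{- Let $\mathbf{h}$ be a weakly increasing sequence of positive integers with $\mathbf{h}(i)>i$ for all $i$. Let $S$ be a nonempty $\mathbf{h}$-admissible set and $m=\mathbf{m}(S)$. Then, as polynomials in $n$ (equivalently, for all integers $n\ge\mathbf{j}(S)$), $$\mathcal{I}_\mathbf{h}(S;n)=\sum_{k=0}^{m} a_k(S)\binom{n-\mathbf{h}(m)+1}{k},$$ where, with $N=m+\mathbf{h}(m)-1$, $$a_k(S)=\#\{\pi\in I_\mathbf{h}(S,N):\ \{\pi_1,\dots,\pi_m\}\cap[\mathbf{h}(m),N]=[\mathbf{h}(m),\mathbf{h}(m)+k-1]\}$$ (for $k=0$ the interval on the right is empty).
   Context: $\mathcal{P}_\mathbf{h}=\{(i,j): i<j\le \mathbf{h}(i)\}$. For $\pi\in S_n$ (one-line notation $\pi_1\cdots\pi_n$), $\mathrm{inv}_\mathbf{h}(\pi)=\{(i,j)\in\mathcal{P}_\mathbf{h}: j\le n,\ \pi_i>\pi_j\}$. $S\subseteq\mathcal{P}_\mathbf{h}$ is $\mathbf{h}$-admissible if $S=\mathrm{inv}_\mathbf{h}(\pi)$ for some permutation $\pi$ of some $S_n$. $I_\mathbf{h}(S,n)=\{\pi\in S_n:\mathrm{inv}_\mathbf{h}(\pi)=S\}$, $\mathcal{I}_\mathbf{h}(S;n)=\#I_\mathbf{h}(S,n)$; $\mathbf{j}(S)=\max\{j:(i,j)\in S\}$, and $\mathcal{I}_\mathbf{h}(S;n)$ agrees with a polynomial in $n$ for $n\ge\mathbf{j}(S)$. $\mathbf{m}(S)=\max\{i:(i,i+1)\in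 S\}$. $[a,b]=\{a,a+1,\dots,b\}$. -}

module Defs where

open import Data.Nat using (ℕ; zero; suc; _+_; _∸_; _≤_; _<_; _⊔_; _≡ᵇ_; _!)
open import Data.Nat.Properties using (_≤?_; _<?_; _!≢0)
import Data.Nat.Properties as ℕP
open import Data.Integer as ℤ using (ℤ; +_; _/ℕ_)
open import Data.Bool using (if_then_else_)
open import Data.Product using (_×_; _,_; proj₁; proj₂; ∃-syntax)
import Data.Product.Properties as ×P
open import Data.List using (List; []; _∷_; [_]; map; concatMap; filter; length; upTo; foldr; take; sum)
open import Data.List.Relation.Unary.All using (All; all?)
import Data.List.Membership.DecPropositional as DecMem
open import Data.List.Membership.Propositional using (_∈_)
open import Relation.Nullary using (Dec)
open import Relation.Nullary.Decidable using (_×-dec_)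
open import Relation.Binary using (DecidableEquality)

-- Sequences h : positive integers → positive integers (h 0 is irrelevant)

WeaklyIncreasing : (ℕ → ℕ) → Set
WeaklyIncreasing h = ∀ {i j} → 1 ≤ i → i ≤ j → h i ≤ h j

AboveDiagonal : (ℕ → ℕ) → Set
AboveDiagonal h = ∀ i → 1 ≤ i → i < h i

range : ℕ → ℕ → List ℕ
range a len = map (λ i → a + i) (upTo len)

interval : ℕ → ℕ → List ℕ
interval a b = range a (suc b ∸ a)

module _ {A : Set} (_≟_ : DecidableEquality A) where
  open DecMem _≟_ using (_∈?_)

  SameSet : List A → List A → Set
  SameSet xs ys = All (_∈ ys) xs × All (_∈ xs) ys

  sameSet? : (xs ys : List A) → Dec (SameSet xs ys)
  sameSet? xs ys = all? (_∈? ys) xs ×-dec all? (_∈? xs) ys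

≟ℕ×ℕ : DecidableEquality (ℕ × ℕ)
≟ℕ×ℕ = ×P.≡-dec ℕP._≟_ ℕP._≟_

-- Permutations in one-line notation π₁ ⋯ πₙ (lists of values)

insertEverywhere : ℕ → List ℕ → List (List ℕ)
insertEverywhere x []       = [ x ∷ [] ]
insertEverywhere x (y ∷ ys) = (x ∷ y ∷ ys) ∷ map (y ∷_) (insertEverywhere x ys)

perms : List ℕ → List (List ℕ)
perms []       = [ [] ]
perms (x ∷ xs) = concatMap (insertEverywhere x) (perms xs)

Sym : ℕ → List (List ℕ)
Sym n = perms (interval 1 n)

-- π_i (1-indexed position i)
at : List ℕ → ℕ → ℕ
at []       _             = 0
at (x ∷ xs) zero          = 0
at (x ∷ xs) (suc zero)    = x
at (x ∷ xs) (suc (suc i)) = at xs (suc i)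

pairsUpTo : (ℕ → ℕ) → ℕ → List (ℕ × ℕ)
pairsUpTo h n =
  concatMap (λ i → map (i ,_) (filter (λ j → j ≤? h i) (interval (suc i) n)))
            (interval 1 n)

invList : (ℕ → ℕ) → List ℕ → List (ℕ × ℕ)
invList h π = filter (λ p → at π (proj₂ p) <? at π (proj₁ p)) (pairsUpTo h (length π))

-- h-admissible sets (S given as a finite list, read as a set)

Admissible : (ℕ → ℕ) → List (ℕ × ℕ) → Set
Admissible h S = ∃[ n ] ∃[ π ] (π ∈ Sym n × SameSet ≟ℕ×ℕ (invList h π) S)

Ilist : (ℕ → ℕ) → List (ℕ × ℕ) → ℕ → List (List ℕ)
Ilist h S n = filter (λ π → sameSet? ≟ℕ×ℕ (invList h π) S) (Sym n)

Icount : (ℕ → ℕ) → List (ℕ × ℕ) → ℕ → ℕ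
Icount h S n = length (Ilist h S n)

jS : List (ℕ × ℕ) → ℕ
jS S = foldr (λ p acc → proj₂ p ⊔ acc) 0 S

-- m(S) = max { i : (i,i+1) ∈ S }   (0 if there is no such pair)
mS : List (ℕ × ℕ) → ℕ
mS S = foldr (λ p acc → if proj₂ p ≡ᵇ suc (proj₁ p) then proj₁ p ⊔ acc else acc) 0 S

aCoeff : (ℕ → ℕ) → List (ℕ × ℕ) → ℕ → ℕ
aCoeff h S k = length (filter cond (Ilist h S N))
  where
  m = mS S
  N = m + h m ∸ 1
  cond : (π : List ℕ) → Dec _
  cond π = sameSet? ℕP._≟_
             (filter (λ v → h m ≤? v ×-dec v ≤? N) (take m π))
             (range (h m) k)

falling : ℤ → ℕ → ℤ
falling x zero    = + 1
falling x (suc k) = falling x k ℤ.* (x ℤ.- + k)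

binomℤ : ℤ → ℕ → ℤ
binomℤ x k = (falling x k /ℕ (k !)) {{k !≢0}}

rhs : (ℕ → ℕ) → List (ℕ × ℕ) → ℕ → ℤ
rhs h S n = sumℤ (map (λ k → + aCoeff h S k ℤ.* binomℤ (+ n ℤ.- + h m ℤ.+ + 1) k) (upTo (suc m)))
  where
  m = mS S
  sumℤ : List ℤ → ℤ
  sumℤ = foldr ℤ._+_ (+ 0)

{-# OPTIONS --safe #-}

-- Write G = min (j(S) + 1, h(m)).  For π ∈ I_h(S,n) the entries after position m increase, and
-- if π_i ≥ G with i ≤ m < j ≤ h(i) then π_j < G.  Hence exchanging two consecutive values v, v+1 ≥ G,
-- exactly one of which occurs among π₁ … π_m, preserves the h-inversion set; and for n ≥ j(S),
-- appending n + 1 maps I_h(S,n) bijectively onto the π′ ∈ I_h(S,n+1) with n + 1 ∉ {π′₁ … π′_m}.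
-- So the number of π with {π₁ … π_m} ∩ [G,n] = T depends only on k = |T|; call it φ(k), which
-- vanishes for k > m.  Summing over T gives 𝓘_h(S;n) = Σ_{T ⊆ [G,n]} φ(|T|), and likewise
-- a_k(S) = Σ_{T ⊆ [G,h(m))} φ(|T| + k).  Both sides of the theorem are thereby values of
-- Φ(s,y) = Σ_j φ(s+j) binom(y,j), and they agree by Σ_{T ⊆ A} Φ(s + |T|, y) = Φ(s, y + |A|),
-- a consequence of Pascal's rule.

module Submission where

open import Defs
open import Data.Nat using (ℕ; _≤_)
open import Function using (_∘_; id)
open import Data.Empty using (⊥; ⊥-elim)
open import Data.Product using (_×_; _,_; proj₁; proj₂; ∃-syntax; uncurry)
open import Data.Sum using (_⊎_; inj₁; inj₂; [_,_]′; map₂)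
open import Data.List using (List; []; _∷_; _++_; [_]; length; map; filter; take; upTo)
open import Data.List.Membership.Propositional using (_∈_; _∉_)
open import Data.List.Membership.Propositional.Properties
open import Data.List.Relation.Unary.Any using (here; there)
open import Data.List.Relation.Unary.All as All using (All; []; _∷_)
open import Data.List.Relation.Unary.All.Properties using (¬Any⇒All¬; All¬⇒¬Any)
open import Data.List.Relation.Unary.AllPairs using (AllPairs; []; _∷_)
open import Data.List.Relation.Unary.Unique.Propositional using (Unique)
import Data.List.Relation.Unary.Unique.Propositional.Properties as Unique
open import Data.List.Relation.Binary.Subset.Propositional using (_⊆_)
open import Relation.Binary.PropositionalEquality hiding ([_]; J)
open import Relation.Nullary
open import Relation.Unary using (Pred; Decidable)

module ListFacts where

  open import Data.Nat using (ℕ; suc; _≤_; _<_; z≤n; s≤s)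
  open import Data.Nat.Properties using (_≟_; ≤-antisym; <-irrefl; <-asym; m≤n⇒m≤1+n)
  open import Data.Bool using (true; false)
  open import Data.List.Properties using (length-++-sucʳ; ∷-injectiveʳ)
  import Data.List.Membership.DecPropositional as DecMembership
  open import Data.List using (concatMap)
  open import Data.List.Membership.Propositional using (find)
  import Data.List.Relation.Unary.AllPairs as AllPairs
  import Data.List.Relation.Unary.AllPairs.Properties as AllPairsP
  open import Level using (0ℓ)
  open import Relation.Binary using (DecidableEquality)

  private variable A B : Set

  ≢[]⇒∃∈ : (xs : List A) → xs ≢ [] → ∃[ x ] x ∈ xs
  ≢[]⇒∃∈ []       xs≢[] = ⊥-elim (xs≢[] refl)
  ≢[]⇒∃∈ (x ∷ xs) _     = x , here refl

  ∈-insert⁻ : ∀ {v x : A} as bs → v ∈ as ++ x ∷ bs → v ≡ x ⊎ v ∈ as ++ bs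
  ∈-insert⁻ []       bs (here v≡x) = inj₁ v≡x
  ∈-insert⁻ []       bs (there v∈) = inj₂ v∈
  ∈-insert⁻ (a ∷ as) bs (here v≡a) = inj₂ (here v≡a)
  ∈-insert⁻ (a ∷ as) bs (there v∈) = map₂ there (∈-insert⁻ as bs v∈)

  ∈-insert⁺ : ∀ {v x : A} as bs → v ∈ as ++ bs → v ∈ as ++ x ∷ bs
  ∈-insert⁺ []       bs v∈         = there v∈
  ∈-insert⁺ (a ∷ as) bs (here v≡a) = here v≡a
  ∈-insert⁺ (a ∷ as) bs (there v∈) = there (∈-insert⁺ as bs v∈)

  ∈-insert-≢ : ∀ {v x : A} as bs → v ≢ x → v ∈ as ++ x ∷ bs → v ∈ as ++ bs
  ∈-insert-≢ as bs v≢x v∈ = [ ⊥-elim ∘ v≢x , id ]′ (∈-insert⁻ as bs v∈)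

  unique-insert⁺ : ∀ {x : A} as bs → Unique (as ++ bs) → x ∉ as ++ bs → Unique (as ++ x ∷ bs)
  unique-insert⁺ []       bs u x∉ = ¬Any⇒All¬ _ x∉ ∷ u
  unique-insert⁺ (a ∷ as) bs (a∉ ∷ u) x∉ = All.tabulate a≢ ∷ unique-insert⁺ as bs u (x∉ ∘ there)
    where
    a≢ : ∀ {v} → v ∈ as ++ _ ∷ bs → a ≢ v
    a≢ v∈ = [ (λ v≡x a≡v → x∉ (here (sym (trans a≡v v≡x)))) , All.lookup a∉ ]′ (∈-insert⁻ as bs v∈)

  unique-insert⁻ : ∀ {x : A} as bs → Unique (as ++ x ∷ bs) → Unique (as ++ bs) × x ∉ as ++ bs
  unique-insert⁻ []       bs (x∉ ∷ u) = u , All¬⇒¬Any x∉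
  unique-insert⁻ (a ∷ as) bs (a∉ ∷ u) with unique-insert⁻ as bs u
  ... | u′ , x∉ = All.tabulate (All.lookup a∉ ∘ ∈-insert⁺ as bs) ∷ u′ , λ where
    (here x≡a)  → All.lookup a∉ (∈-insert as) (sym x≡a)
    (there x∈) → x∉ x∈

  concatMap-unique : ∀ (f : A → List B) {L} → Unique L → (∀ {l} → l ∈ L → Unique (f l)) →
                     (∀ {l l′ b} → l ∈ L → l′ ∈ L → b ∈ f l → b ∈ f l′ → l ≡ l′) →
                     Unique (concatMap f L)
  concatMap-unique f {[]}    _        _      _      = []
  concatMap-unique f {l ∷ L} (l∉ ∷ u) uniqF source =
    Unique.++⁺ (uniqF (here refl)) (concatMap-unique f u (uniqF ∘ there) (λ p q → source (there p) (there q)))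
      λ (b∈l , b∈L) → let l′ , l′∈ , b∈l′ = find (∈-concatMap⁻ f {xs = L} b∈L) in
        All.lookup l∉ l′∈ (source (here refl) (there l′∈) b∈l b∈l′)

  injectiveOn⇒length≤ : (f : A → B) {xs : List A} {ys : List B} →
                        (∀ {x y} → x ∈ xs → y ∈ xs → f x ≡ f y → x ≡ y) →
                        Unique xs → (∀ {x} → x ∈ xs → f x ∈ ys) → length xs ≤ length ys
  injectiveOn⇒length≤ f {[]}     inj u        maps = z≤n
  injectiveOn⇒length≤ f {x ∷ xs} inj (x∉ ∷ u) maps with ∈-∃++ (maps (here refl))
  ... | as , bs , refl = subst (suc (length xs) ≤_) (sym (length-++-sucʳ as (f x) bs))
                           (s≤s (injectiveOn⇒length≤ f (λ p q → inj (there p) (there q)) u maps′))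
    where
    maps′ : ∀ {y} → y ∈ xs → f y ∈ as ++ bs
    maps′ y∈ = [ (λ fy≡fx → ⊥-elim (All.lookup x∉ y∈ (inj (here refl) (there y∈) (sym fy≡fx)))) , id ]′
                 (∈-insert⁻ as bs (maps (there y∈)))

  ⊆⇒length≤ : {xs ys : List A} → Unique xs → xs ⊆ ys → length xs ≤ length ys
  ⊆⇒length≤ = injectiveOn⇒length≤ id (λ _ _ → id)

  private
    length-filter-≤ : {P : Pred A 0ℓ} {Q : Pred B 0ℓ} (P? : Decidable P) (Q? : Decidable Q)
                      (f : A → B) (g : B → A) {xs : List A} {ys : List B} → Unique xs →
                      (∀ {x} → x ∈ xs → P x → f x ∈ ys × Q (f x)) → (∀ {x} → x ∈ xs → P x → g (f x) ≡ x) →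
                      length (filter P? xs) ≤ length (filter Q? ys)
    length-filter-≤ P? Q? f g {xs} {ys} u f∈ gf = injectiveOn⇒length≤ f inj (Unique.filter⁺ P? u) maps
      where
      retract : ∀ {x} → x ∈ filter P? xs → g (f x) ≡ x
      retract x∈ = uncurry gf (∈-filter⁻ P? x∈)
      inj : ∀ {x y} → x ∈ filter P? xs → y ∈ filter P? xs → f x ≡ f y → x ≡ y
      inj x∈ y∈ fx≡fy = trans (sym (retract x∈)) (trans (cong g fx≡fy) (retract y∈))
      maps : ∀ {x} → x ∈ filter P? xs → f x ∈ filter Q? ys
      maps x∈ = uncurry (∈-filter⁺ Q?) (uncurry f∈ (∈-filter⁻ P? x∈))

  length-filter-bijection : {P : Pred A 0ℓ} {Q : Pred B 0ℓ} (P? : Decidable P) (Q? : Decidable Q)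
    (f : A → B) (g : B → A) {xs : List A} {ys : List B} → Unique xs → Unique ys →
    (∀ {x} → x ∈ xs → P x → f x ∈ ys × Q (f x)) → (∀ {y} → y ∈ ys → Q y → g y ∈ xs × P (g y)) →
    (∀ {x} → x ∈ xs → P x → g (f x) ≡ x) → (∀ {y} → y ∈ ys → Q y → f (g y) ≡ y) →
    length (filter P? xs) ≡ length (filter Q? ys)
  length-filter-bijection P? Q? f g ux uy f∈ g∈ gf fg =
    ≤-antisym (length-filter-≤ P? Q? f g ux f∈ gf) (length-filter-≤ Q? P? g f uy g∈ fg)

  filter-comm : {P Q : Pred A 0ℓ} (P? : Decidable P) (Q? : Decidable Q) (xs : List A) →
                filter P? (filter Q? xs) ≡ filter Q? (filter P? xs)
  filter-comm P? Q? []       = refl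
  filter-comm P? Q? (x ∷ xs) with Q? x in eqQ | P? x in eqP
  ... | yes _ | yes _ rewrite eqP | eqQ = cong (x ∷_) (filter-comm P? Q? xs)
  ... | yes _ | no  _ rewrite eqP       = filter-comm P? Q? xs
  ... | no  _ | yes _ rewrite eqQ       = filter-comm P? Q? xs
  ... | no  _ | no  _                   = filter-comm P? Q? xs

  Ascending : List ℕ → Set
  Ascending = AllPairs _<_

  ascending⇒unique : {xs : List ℕ} → Ascending xs → Unique xs
  ascending⇒unique = AllPairs.map (λ x<y x≡y → <-irrefl x≡y x<y)

  private
    ⊆-tail : ∀ {x} {xs ys : List ℕ} → All (x <_) xs → x ∷ xs ⊆ x ∷ ys → xs ⊆ ys
    ⊆-tail x< ⊆xys u∈ with ⊆xys (there u∈)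
    ... | here refl = ⊥-elim (<-irrefl refl (All.lookup x< u∈))
    ... | there u∈′ = u∈′

  ascending-≡ : {xs ys : List ℕ} → Ascending xs → Ascending ys → xs ⊆ ys → ys ⊆ xs → xs ≡ ys
  ascending-≡ {[]}     {[]}     _ _ _ _ = refl
  ascending-≡ {[]}     {y ∷ ys} _ _ _ ys⊆ with ys⊆ (here refl)
  ... | ()
  ascending-≡ {x ∷ xs} {[]}     _ _ xs⊆ _ with xs⊆ (here refl)
  ... | ()
  ascending-≡ {x ∷ xs} {y ∷ ys} (x< ∷ ↑xs) (y< ∷ ↑ys) xs⊆ ys⊆ with xs⊆ (here refl) | ys⊆ (here refl)
  ... | here refl  | _          = cong (x ∷_) (ascending-≡ ↑xs ↑ys (⊆-tail x< xs⊆) (⊆-tail y< ys⊆))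
  ... | there x∈ys | here refl  = ⊥-elim (<-irrefl refl (All.lookup y< x∈ys))
  ... | there x∈ys | there y∈xs = ⊥-elim (<-asym (All.lookup x< y∈xs) (All.lookup y< x∈ys))

  sublists : List A → List (List A)
  sublists []       = [ [] ]
  sublists (x ∷ xs) = map (x ∷_) (sublists xs) ++ sublists xs

  private
    ∈-sublists-∷ : ∀ (x : A) xs {T} → T ∈ sublists (x ∷ xs) →
                   (∃[ T′ ] T′ ∈ sublists xs × T ≡ x ∷ T′) ⊎ T ∈ sublists xs
    ∈-sublists-∷ x xs T∈ with ∈-++⁻ (map (x ∷_) (sublists xs)) T∈
    ... | inj₁ T∈′ = inj₁ (∈-map⁻ (x ∷_) T∈′)
    ... | inj₂ T∈′ = inj₂ T∈′

  sublist⇒⊆ : {xs T : List A} → T ∈ sublists xs → T ⊆ xs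
  sublist⇒⊆ {xs = []}     (here refl) ()
  sublist⇒⊆ {xs = x ∷ xs} T∈ u∈ with ∈-sublists-∷ x xs T∈
  ... | inj₂ T∈′ = there (sublist⇒⊆ T∈′ u∈)
  ... | inj₁ (T′ , T′∈ , refl) with u∈
  ...   | here refl = here refl
  ...   | there u∈′ = there (sublist⇒⊆ T′∈ u∈′)

  sublists-unique : {xs : List A} → Unique xs → Unique (sublists xs)
  sublists-unique {xs = []}     _        = [] ∷ []
  sublists-unique {xs = x ∷ xs} (x∉ ∷ u) =
    Unique.++⁺ (Unique.map⁺ ∷-injectiveʳ (sublists-unique u)) (sublists-unique u) disjoint
    where
    disjoint : ∀ {T} → T ∈ map (x ∷_) (sublists xs) × T ∈ sublists xs → ⊥
    disjoint (T∈₁ , T∈₂) with ∈-map⁻ (x ∷_) T∈₁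
    ... | _ , _ , refl = All.lookup x∉ (sublist⇒⊆ T∈₂ (here refl)) refl

  length-sublist : {xs T : List A} → T ∈ sublists xs → length T ≤ length xs
  length-sublist {xs = []}     (here refl) = z≤n
  length-sublist {xs = x ∷ xs} T∈ with ∈-sublists-∷ x xs T∈
  ... | inj₁ (T′ , T′∈ , refl) = s≤s (length-sublist {xs = xs} T′∈)
  ... | inj₂ T∈′               = m≤n⇒m≤1+n (length-sublist {xs = xs} T∈′)

  filter∈sublists : {P : Pred A 0ℓ} (P? : Decidable P) (xs : List A) → filter P? xs ∈ sublists xs
  filter∈sublists P? []       = here refl
  filter∈sublists P? (x ∷ xs) with does (P? x)
  ... | true  = ∈-++⁺ˡ (∈-map⁺ (x ∷_) (filter∈sublists P? xs))
  ... | false = ∈-++⁺ʳ (map (x ∷_) (sublists xs)) (filter∈sublists P? xs)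

  ++∈sublists : ∀ (xs : List A) {ys T U} → T ∈ sublists xs → U ∈ sublists ys → T ++ U ∈ sublists (xs ++ ys)
  ++∈sublists []       (here refl) U∈ = U∈
  ++∈sublists (x ∷ xs) {ys} T∈ U∈ with ∈-sublists-∷ x xs T∈
  ... | inj₁ (T′ , T′∈ , refl) = ∈-++⁺ˡ (∈-map⁺ (x ∷_) (++∈sublists xs T′∈ U∈))
  ... | inj₂ T∈′               = ∈-++⁺ʳ (map (x ∷_) (sublists (xs ++ ys))) (++∈sublists xs T∈′ U∈)

  ascending-sublist : {xs T : List ℕ} → Ascending xs → T ∈ sublists xs → Ascending T
  ascending-sublist {[]}     _          (here refl) = []
  ascending-sublist {x ∷ xs} (x< ∷ ↑xs) T∈ with ∈-sublists-∷ x xs T∈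
  ... | inj₁ (T′ , T′∈ , refl) = All.tabulate (All.lookup x< ∘ sublist⇒⊆ T′∈) ∷ ascending-sublist ↑xs T′∈
  ... | inj₂ T∈′               = ascending-sublist ↑xs T∈′

  ascending-⊆⇒∈sublists : {xs T : List ℕ} → Ascending xs → Ascending T → T ⊆ xs → T ∈ sublists xs
  ascending-⊆⇒∈sublists {xs} {T} ↑xs ↑T T⊆xs = subst (_∈ sublists xs) filter≡T (filter∈sublists (_∈? T) xs)
    where
    open DecMembership _≟_ using (_∈?_)
    filter≡T : filter (_∈? T) xs ≡ T
    filter≡T = ascending-≡ (AllPairsP.filter⁺ (_∈? T) ↑xs) ↑T
                 (proj₂ ∘ ∈-filter⁻ (_∈? T) {xs = xs}) (λ u∈T → ∈-filter⁺ (_∈? T) (T⊆xs u∈T) u∈T)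

  sameSet⁻ : ∀ (_≟_ : DecidableEquality A) {xs ys} → SameSet _≟_ xs ys → xs ⊆ ys × ys ⊆ xs
  sameSet⁻ _ (xs⊆ , ys⊆) = All.lookup xs⊆ , All.lookup ys⊆

  sameSet⁺ : ∀ (_≟_ : DecidableEquality A) {xs ys} → xs ⊆ ys → ys ⊆ xs → SameSet _≟_ xs ys
  sameSet⁺ _ xs⊆ ys⊆ = All.tabulate xs⊆ , All.tabulate ys⊆

  sameSet-resp : ∀ (_≟_ : DecidableEquality A) {xs xs′ ys} → xs ⊆ xs′ → xs′ ⊆ xs → SameSet _≟_ xs ys → SameSet _≟_ xs′ ys
  sameSet-resp _ to from (xs⊆ , ys⊆) = All.tabulate (All.lookup xs⊆ ∘ from) , All.tabulate (to ∘ All.lookup ys⊆)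

module Intervals where

  open ListFacts

  open import Data.Nat using (suc; _+_; _∸_; _≤_; _<_; _≤?_; s≤s)
  open import Data.Nat.Properties
  open import Data.List.Properties using (map-++; map-upTo; upTo-∷ʳ; length-map; length-upTo)
  import Data.List.Relation.Unary.AllPairs.Properties as AllPairsP

  ∈-range⁺ : ∀ {a L v} → a ≤ v → v < a + L → v ∈ range a L
  ∈-range⁺ {a} {L} {v} a≤v v<a+L = subst (_∈ range a L) (m+[n∸m]≡n a≤v)
    (∈-map⁺ (a +_) (∈-upTo⁺ (+-cancelˡ-< a _ _ (subst (_< a + L) (sym (m+[n∸m]≡n a≤v)) v<a+L))))

  ∈-range⁻ : ∀ {a L v} → v ∈ range a L → a ≤ v × v < a + L
  ∈-range⁻ {a} v∈ with ∈-map⁻ (a +_) v∈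
  ... | i , i∈ , refl = m≤m+n a i , +-monoʳ-< a (∈-upTo⁻ i∈)

  range-ascending : ∀ a L → Ascending (range a L)
  range-ascending a L = subst Ascending (sym (map-upTo (a +_) L))
    (AllPairsP.applyUpTo⁺₁ (a +_) L (λ i<j _ → +-monoʳ-< a i<j))

  length-range : ∀ a L → length (range a L) ≡ L
  length-range a L = trans (length-map (a +_) (upTo L)) (length-upTo L)

  range-∷ʳ : ∀ a L → range a L ++ [ a + L ] ≡ range a (suc L)
  range-∷ʳ a L = trans (sym (map-++ (a +_) (upTo L) [ L ])) (cong (map (a +_)) (upTo-∷ʳ L))

  ∈-interval⁺ : ∀ {a b v} → a ≤ v → v ≤ b → v ∈ interval a b
  ∈-interval⁺ {a} {b} {v} a≤v v≤b =
    ∈-range⁺ a≤v (subst (v <_) (sym (m+[n∸m]≡n (≤-trans a≤v (m≤n⇒m≤1+n v≤b)))) (s≤s v≤b))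

  ∈-interval⁻ : ∀ {a b v} → v ∈ interval a b → a ≤ v × v ≤ b
  ∈-interval⁻ {a} {b} {v} v∈ with ∈-range⁻ {a} {suc b ∸ a} v∈ | a ≤? suc b
  ... | a≤v , v< | yes a≤1+b = a≤v , ≤-pred (subst (v <_) (m+[n∸m]≡n a≤1+b) v<)
  ... | a≤v , v< | no  a≰1+b = ⊥-elim (<⇒≱ (subst (v <_) a+0≡a v<) a≤v)
    where
    a+0≡a : a + (suc b ∸ a) ≡ a
    a+0≡a = trans (cong (a +_) (m≤n⇒m∸n≡0 (<⇒≤ (≰⇒> a≰1+b)))) (+-identityʳ a)

  interval-ascending : ∀ a b → Ascending (interval a b)
  interval-ascending a b = range-ascending a (suc b ∸ a)

module Positions where

  open import Data.Nat using (ℕ; zero; suc; _≤_; z≤n; s≤s)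
  open import Data.Nat.Properties using (suc-injective)

  at-∈ : ∀ π {p} → 1 ≤ p → p ≤ length π → at π p ∈ π
  at-∈ (x ∷ π) {suc zero}    _ _         = here refl
  at-∈ (x ∷ π) {suc (suc i)} _ (s≤s p≤) = there (at-∈ π (s≤s z≤n) p≤)

  ∈⇒at : ∀ π {v} → v ∈ π → ∃[ p ] (1 ≤ p × p ≤ length π × at π p ≡ v)
  ∈⇒at (x ∷ π) (here refl) = 1 , s≤s z≤n , s≤s z≤n , refl
  ∈⇒at (x ∷ π) (there v∈) with ∈⇒at π v∈
  ... | suc i , _ , p≤ , at≡v = suc (suc i) , s≤s z≤n , s≤s p≤ , at≡v

  at-map : ∀ (f : ℕ → ℕ) π {p} → 1 ≤ p → p ≤ length π → at (map f π) p ≡ f (at π p)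
  at-map f (x ∷ π) {suc zero}    _ _         = refl
  at-map f (x ∷ π) {suc (suc i)} _ (s≤s p≤) = at-map f π (s≤s z≤n) p≤

  at-injective : ∀ π → Unique π → ∀ {p q} → 1 ≤ p → p ≤ length π → 1 ≤ q → q ≤ length π →
                 at π p ≡ at π q → p ≡ q
  at-injective (x ∷ π) u        {suc zero}    {suc zero}    _ _ _ _ _ = refl
  at-injective (x ∷ π) (x∉ ∷ u) {suc zero}    {suc (suc j)} _ _ _ (s≤s q≤) x≡ =
    ⊥-elim (All.lookup x∉ (at-∈ π (s≤s z≤n) q≤) x≡)
  at-injective (x ∷ π) (x∉ ∷ u) {suc (suc i)} {suc zero}    _ (s≤s p≤) _ _ ≡x =
    ⊥-elim (All.lookup x∉ (at-∈ π (s≤s z≤n) p≤) (sym ≡x))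
  at-injective (x ∷ π) (x∉ ∷ u) {suc (suc i)} {suc (suc j)} _ (s≤s p≤) _ (s≤s q≤) at≡ =
    cong suc (at-injective π u (s≤s z≤n) p≤ (s≤s z≤n) q≤ at≡)

  at-++ˡ : ∀ π ys {p} → 1 ≤ p → p ≤ length π → at (π ++ ys) p ≡ at π p
  at-++ˡ (x ∷ π) ys {suc zero}    _ _         = refl
  at-++ˡ (x ∷ π) ys {suc (suc i)} _ (s≤s p≤) = at-++ˡ π ys (s≤s z≤n) p≤

  at-∷ʳ : ∀ π x → at (π ++ [ x ]) (suc (length π)) ≡ x
  at-∷ʳ []      x = refl
  at-∷ʳ (y ∷ π) x = at-∷ʳ π x

  ∈-take⁻ : ∀ m π {u} → u ∈ take m π → ∃[ p ] (1 ≤ p × p ≤ m × p ≤ length π × at π p ≡ u)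
  ∈-take⁻ (suc m) (x ∷ π) (here refl) = 1 , s≤s z≤n , s≤s z≤n , s≤s z≤n , refl
  ∈-take⁻ (suc m) (x ∷ π) (there u∈) with ∈-take⁻ m π u∈
  ... | suc i , _ , p≤m , p≤ , at≡u = suc (suc i) , s≤s z≤n , s≤s p≤m , s≤s p≤ , at≡u

  ∈-take⁺ : ∀ m π {p} → 1 ≤ p → p ≤ m → p ≤ length π → at π p ∈ take m π
  ∈-take⁺ (suc m) (x ∷ π) {suc zero}    _ _          _         = here refl
  ∈-take⁺ (suc m) (x ∷ π) {suc (suc i)} _ (s≤s p≤m) (s≤s p≤) = there (∈-take⁺ m π (s≤s z≤n) p≤m p≤)

  take-++ˡ : ∀ m π (ys : List ℕ) → m ≤ length π → take m (π ++ ys) ≡ take m π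
  take-++ˡ zero    π       ys _         = refl
  take-++ˡ (suc m) (x ∷ π) ys (s≤s m≤) = cong (x ∷_) (take-++ˡ m π ys m≤)

  ∷ʳ-take : ∀ n π x → length π ≡ suc n → at π (suc n) ≡ x → π ≡ take n π ++ [ x ]
  ∷ʳ-take zero    (y ∷ []) x _       at≡x = cong [_] at≡x
  ∷ʳ-take (suc n) (y ∷ π)  x len≡ at≡x = cong (y ∷_) (∷ʳ-take n π x (suc-injective len≡) at≡x)

  ∈-take⇒∈ : ∀ m (π : List ℕ) {u} → u ∈ take m π → u ∈ π
  ∈-take⇒∈ (suc m) (x ∷ π) (here refl) = here refl
  ∈-take⇒∈ (suc m) (x ∷ π) (there u∈)  = there (∈-take⇒∈ m π u∈)

module Permutations where

  open ListFacts
  open Intervals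

  open import Data.Nat using (ℕ; suc; _≤_; z≤n; s≤s)
  open import Data.Nat.Properties using (≤-refl; ≤-pred; m≤n⇒m≤1+n; m≤n⇒m<n∨m≡n; 1+n≰n)
  open import Data.List.Properties using (length-++-sucʳ; ∷-injectiveˡ; ∷-injectiveʳ; ++-identityʳ)
  open import Data.List.Membership.Propositional using (find; lose)

  private
    ∈-insertEverywhere⁻ : ∀ x ys {π} → π ∈ insertEverywhere x ys →
                          ∃[ as ] ∃[ bs ] (ys ≡ as ++ bs × π ≡ as ++ x ∷ bs)
    ∈-insertEverywhere⁻ x []       (here refl) = [] , [] , refl , refl
    ∈-insertEverywhere⁻ x (y ∷ ys) (here refl) = [] , y ∷ ys , refl , refl
    ∈-insertEverywhere⁻ x (y ∷ ys) (there π∈) with ∈-map⁻ (y ∷_) π∈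
    ... | π′ , π′∈ , refl with ∈-insertEverywhere⁻ x ys π′∈
    ... | as , bs , refl , refl = y ∷ as , bs , refl , refl

    ∈-insertEverywhere⁺ : ∀ x as bs → as ++ x ∷ bs ∈ insertEverywhere x (as ++ bs)
    ∈-insertEverywhere⁺ x []       []       = here refl
    ∈-insertEverywhere⁺ x []       (b ∷ bs) = here refl
    ∈-insertEverywhere⁺ x (a ∷ as) bs       = there (∈-map⁺ (a ∷_) (∈-insertEverywhere⁺ x as bs))

    ∈-perms-∷ : ∀ x xs {π} → π ∈ perms (x ∷ xs) → ∃[ as ] ∃[ bs ] (as ++ bs ∈ perms xs × π ≡ as ++ x ∷ bs)
    ∈-perms-∷ x xs π∈ with find (∈-concatMap⁻ (insertEverywhere x) {xs = perms xs} π∈)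
    ... | π′ , π′∈ , π∈′ with ∈-insertEverywhere⁻ x π′ π∈′
    ... | as , bs , refl , π≡ = as , bs , π′∈ , π≡

    insertEverywhere-unique : ∀ x ys → x ∉ ys → Unique (insertEverywhere x ys)
    insertEverywhere-unique x []       _  = [] ∷ []
    insertEverywhere-unique x (y ∷ ys) x∉ =
      All.tabulate head≢ ∷ Unique.map⁺ ∷-injectiveʳ (insertEverywhere-unique x ys (x∉ ∘ there))
      where
      head≢ : ∀ {π} → π ∈ map (y ∷_) (insertEverywhere x ys) → x ∷ y ∷ ys ≢ π
      head≢ π∈ ≡π with ∈-map⁻ (y ∷_) π∈
      ... | _ , _ , refl = x∉ (here (∷-injectiveˡ ≡π))

    insert-cancel : ∀ {x : ℕ} as bs cs ds → x ∉ as ++ bs → x ∉ cs ++ ds →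
                    as ++ x ∷ bs ≡ cs ++ x ∷ ds → as ++ bs ≡ cs ++ ds
    insert-cancel []       bs []       ds _   _   eq = ∷-injectiveʳ eq
    insert-cancel []       bs (c ∷ cs) ds _   x∉₂ eq = ⊥-elim (x∉₂ (here (∷-injectiveˡ eq)))
    insert-cancel (a ∷ as) bs []       ds x∉₁ _   eq = ⊥-elim (x∉₁ (here (sym (∷-injectiveˡ eq))))
    insert-cancel (a ∷ as) bs (c ∷ cs) ds x∉₁ x∉₂ eq =
      cong₂ _∷_ (∷-injectiveˡ eq) (insert-cancel as bs cs ds (x∉₁ ∘ there) (x∉₂ ∘ there) (∷-injectiveʳ eq))

  ∈-perms⁻ : ∀ xs {π} → Unique xs → π ∈ perms xs → Unique π × π ⊆ xs × xs ⊆ π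
  ∈-perms⁻ []       _        (here refl) = [] , id , id
  ∈-perms⁻ (x ∷ xs) (x∉ ∷ u) π∈ with ∈-perms-∷ x xs π∈
  ... | as , bs , π′∈ , refl with ∈-perms⁻ xs u π′∈
  ... | uπ′ , π′⊆ , ⊆π′ = unique-insert⁺ as bs uπ′ (All¬⇒¬Any x∉ ∘ π′⊆) , ⊆xs , ⊆π
    where
    ⊆xs : as ++ x ∷ bs ⊆ x ∷ xs
    ⊆xs v∈ = [ here , there ∘ π′⊆ ]′ (∈-insert⁻ as bs v∈)
    ⊆π : x ∷ xs ⊆ as ++ x ∷ bs
    ⊆π (here refl) = ∈-insert as
    ⊆π (there v∈) = ∈-insert⁺ as bs (⊆π′ v∈)

  ∈-perms⁺ : ∀ xs {π} → Unique xs → Unique π → π ⊆ xs → xs ⊆ π → π ∈ perms xs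
  ∈-perms⁺ []       {[]}    _ _ _   _   = here refl
  ∈-perms⁺ []       {y ∷ π} _ _ π⊆ _ with π⊆ (here refl)
  ... | ()
  ∈-perms⁺ (x ∷ xs) (x∉ ∷ u) uπ π⊆ ⊆π with ∈-∃++ (⊆π (here refl))
  ... | as , bs , refl with unique-insert⁻ as bs uπ
  ... | uπ′ , x∉π′ = ∈-concatMap⁺ (insertEverywhere x) {xs = perms xs}
    (lose (∈-perms⁺ xs u uπ′ π′⊆ ⊆π′) (∈-insertEverywhere⁺ x as bs))
    where
    π′⊆ : as ++ bs ⊆ xs
    π′⊆ v∈ with π⊆ (∈-insert⁺ as bs v∈)
    ... | here refl = ⊥-elim (x∉π′ v∈)
    ... | there v∈xs = v∈xs
    ⊆π′ : xs ⊆ as ++ bs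
    ⊆π′ v∈ with ∈-insert⁻ as bs (⊆π (there v∈))
    ... | inj₁ refl = ⊥-elim (All.lookup x∉ v∈ refl)
    ... | inj₂ v∈π′ = v∈π′

  perms-unique : ∀ xs → Unique xs → Unique (perms xs)
  perms-unique []       _        = [] ∷ []
  perms-unique (x ∷ xs) (x∉ ∷ u) =
    concatMap-unique (insertEverywhere x) (perms-unique xs u)
      (λ π∈ → insertEverywhere-unique x _ (x∉-perm π∈)) same-origin
    where
    x∉-perm : ∀ {π} → π ∈ perms xs → x ∉ π
    x∉-perm π∈ = All¬⇒¬Any x∉ ∘ proj₁ (proj₂ (∈-perms⁻ xs u π∈))
    same-origin : ∀ {π π′ σ} → π ∈ perms xs → π′ ∈ perms xs →
                  σ ∈ insertEverywhere x π → σ ∈ insertEverywhere x π′ → π ≡ π′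
    same-origin {π} {π′} π∈ π′∈ σ∈ σ∈′
      with ∈-insertEverywhere⁻ x π σ∈ | ∈-insertEverywhere⁻ x π′ σ∈′
    ... | as , bs , refl , refl | cs , ds , refl , σ≡ = insert-cancel as bs cs ds (x∉-perm π∈) (x∉-perm π′∈) σ≡

  length-perms : ∀ xs {π} → π ∈ perms xs → length π ≡ length xs
  length-perms []       (here refl) = refl
  length-perms (x ∷ xs) π∈ with ∈-perms-∷ x xs π∈
  ... | as , bs , π′∈ , refl = trans (length-++-sucʳ as x bs) (cong suc (length-perms xs π′∈))

  record IsPermutation (n : ℕ) (π : List ℕ) : Set where
    field
      unique   : Unique π
      bounded  : ∀ {v} → v ∈ π → 1 ≤ v × v ≤ n
      complete : ∀ {v} → 1 ≤ v → v ≤ n → v ∈ π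

  ∈Sym⇒isPermutation : ∀ n {π} → π ∈ Sym n → IsPermutation n π
  ∈Sym⇒isPermutation n π∈ with ∈-perms⁻ (interval 1 n) (ascending⇒unique (interval-ascending 1 n)) π∈
  ... | u , π⊆ , ⊆π = record
    { unique = u ; bounded = ∈-interval⁻ ∘ π⊆ ; complete = λ 1≤v v≤n → ⊆π (∈-interval⁺ 1≤v v≤n) }

  isPermutation⇒∈Sym : ∀ n {π} → IsPermutation n π → π ∈ Sym n
  isPermutation⇒∈Sym n perm = ∈-perms⁺ (interval 1 n) (ascending⇒unique (interval-ascending 1 n)) unique
    (uncurry ∈-interval⁺ ∘ bounded) (uncurry complete ∘ ∈-interval⁻)
    where open IsPermutation perm

  length-∈Sym : ∀ n {π} → π ∈ Sym n → length π ≡ n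
  length-∈Sym n π∈ = trans (length-perms (interval 1 n) π∈) (length-range 1 n)

  isPermutation-∷ʳ : ∀ {n π} → IsPermutation n π → IsPermutation (suc n) (π ++ [ suc n ])
  isPermutation-∷ʳ {n} {π} perm = record
    { unique   = Unique.++⁺ unique ([] ∷ []) λ (u∈π , u∈[sn]) → sn∉π (subst (_∈ π) (singleton⁻ u∈[sn]) u∈π)
    ; bounded  = λ u∈ → [ (λ u∈π → let 1≤u , u≤n = bounded u∈π in 1≤u , m≤n⇒m≤1+n u≤n) ,
                           (λ u∈[sn] → subst (λ u → 1 ≤ u × u ≤ suc n) (sym (singleton⁻ u∈[sn])) (s≤s z≤n , ≤-refl)) ]′
                         (∈-++⁻ π u∈)
    ; complete = λ 1≤u u≤sn → [ ∈-++⁺ˡ ∘ complete 1≤u ∘ ≤-pred , (λ { refl → ∈-++⁺ʳ π (here refl) }) ]′ (m≤n⇒m<n∨m≡n u≤sn)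
    }
    where
    open IsPermutation perm
    singleton⁻ : ∀ {u x : ℕ} → u ∈ [ x ] → u ≡ x
    singleton⁻ (here u≡x) = u≡x
    sn∉π : suc n ∉ π
    sn∉π sn∈ = 1+n≰n (proj₂ (bounded sn∈))

  isPermutation-∷ʳ⁻ : ∀ {n π} → IsPermutation (suc n) (π ++ [ suc n ]) → IsPermutation n π
  isPermutation-∷ʳ⁻ {n} {π} perm = record
    { unique   = subst Unique (++-identityʳ π) unique′
    ; bounded  = λ {u} u∈ → let 1≤u , u≤sn = bounded (∈-++⁺ˡ u∈) in
                 1≤u , [ ≤-pred , (λ { refl → ⊥-elim (sn∉π (subst (_ ∈_) (sym (++-identityʳ π)) u∈)) }) ]′ (m≤n⇒m<n∨m≡n u≤sn)
    ; complete = λ 1≤u u≤n → [ id , (λ { (here refl) → ⊥-elim (1+n≰n u≤n) }) ]′ (∈-++⁻ π (complete 1≤u (m≤n⇒m≤1+n u≤n)))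
    }
    where
    open IsPermutation perm
    unique′ = proj₁ (unique-insert⁻ π [] unique)
    sn∉π = proj₂ (unique-insert⁻ π [] unique)

module Sums where

  open ListFacts

  open import Data.Nat using (ℕ; suc)
  open import Data.Integer using (ℤ; +_; 0ℤ; 1ℤ; _+_; _*_)
  open import Data.Integer.Properties
    using (+-identityˡ; +-identityʳ; +-assoc; *-distribʳ-+; pos-+; +-commutativeSemigroup)
  open import Algebra.Properties.CommutativeSemigroup +-commutativeSemigroup using (interchange)
  open import Data.List using (foldr)
  open import Data.List.Properties using (map-applyUpTo; upTo-∷ʳ; filter-accept; filter-reject; filter-++; length-++)
  open import Relation.Binary using (DecidableEquality)

  private variable A B : Set

  -- Defined through foldr so that Defs.rhs is definitionally a ∑.
  ∑ : List A → (A → ℤ) → ℤ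
  ∑ xs f = foldr _+_ 0ℤ (map f xs)

  infix 5 ∑
  syntax ∑ xs (λ x → e) = ∑[ x ∈ xs ] e

  ∑-++ : ∀ (xs ys : List A) f → ∑ (xs ++ ys) f ≡ ∑ xs f + ∑ ys f
  ∑-++ []       ys f = sym (+-identityˡ _)
  ∑-++ (x ∷ xs) ys f = trans (cong (_+_ (f x)) (∑-++ xs ys f)) (sym (+-assoc (f x) _ _))

  ∑-map : ∀ (g : A → B) xs f → ∑ (map g xs) f ≡ ∑ xs (f ∘ g)
  ∑-map g []       f = refl
  ∑-map g (x ∷ xs) f = cong (_+_ (f (g x))) (∑-map g xs f)

  ∑-cong : ∀ (xs : List A) {f g} → (∀ {x} → x ∈ xs → f x ≡ g x) → ∑ xs f ≡ ∑ xs g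
  ∑-cong []       f≡g = refl
  ∑-cong (x ∷ xs) f≡g = cong₂ _+_ (f≡g (here refl)) (∑-cong xs (f≡g ∘ there))

  ∑-zero : ∀ (xs : List A) {f} → (∀ {x} → x ∈ xs → f x ≡ 0ℤ) → ∑ xs f ≡ 0ℤ
  ∑-zero xs f≡0 = trans (∑-cong xs {g = λ _ → 0ℤ} f≡0) (∑0 xs)
    where
    ∑0 : ∀ (xs : List A) → ∑[ x ∈ xs ] 0ℤ ≡ 0ℤ
    ∑0 []       = refl
    ∑0 (x ∷ xs) = trans (+-identityˡ _) (∑0 xs)

  ∑-+ : ∀ (xs : List A) f g → ∑[ x ∈ xs ] (f x + g x) ≡ ∑ xs f + ∑ xs g
  ∑-+ []       f g = refl
  ∑-+ (x ∷ xs) f g = trans (cong (_+_ (f x + g x)) (∑-+ xs f g)) (interchange (f x) (g x) (∑ xs f) (∑ xs g))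

  ∑-*ʳ : ∀ (xs : List A) f c → ∑ xs f * c ≡ ∑[ x ∈ xs ] (f x * c)
  ∑-*ʳ []       f c = refl
  ∑-*ʳ (x ∷ xs) f c = trans (*-distribʳ-+ c (f x) (∑ xs f)) (cong (_+_ (f x * c)) (∑-*ʳ xs f c))

  ∑-comm : ∀ (xs : List A) (ys : List B) (f : A → B → ℤ) →
           ∑[ x ∈ xs ] ∑[ y ∈ ys ] f x y ≡ ∑[ y ∈ ys ] ∑[ x ∈ xs ] f x y
  ∑-comm []       ys f = sym (∑-zero ys (λ _ → refl))
  ∑-comm (x ∷ xs) ys f = trans (cong (_+_ (∑[ y ∈ ys ] f x y)) (∑-comm xs ys f)) (sym (∑-+ ys (f x) (λ y → ∑[ x ∈ xs ] f x y)))

  ∑-single : ∀ {xs : List A} {x₀} f → Unique xs → x₀ ∈ xs → (∀ {x} → x ∈ xs → x ≢ x₀ → f x ≡ 0ℤ) →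
             ∑ xs f ≡ f x₀
  ∑-single {xs = x ∷ xs} f (x∉ ∷ u) (here refl) others =
    trans (cong (_+_ (f x)) (∑-zero xs (λ x′∈ → others (there x′∈) (All.lookup x∉ x′∈ ∘ sym)))) (+-identityʳ (f x))
  ∑-single {xs = x ∷ xs} f (x∉ ∷ u) (there x₀∈) others =
    trans (cong (λ s → s + ∑ xs f) (others (here refl) (λ x≡x₀ → All.lookup x∉ x₀∈ x≡x₀)))
          (trans (+-identityˡ (∑ xs f)) (∑-single f u x₀∈ (others ∘ there)))

  ∑-upTo-suc : ∀ L (f : ℕ → ℤ) → ∑ (upTo (suc L)) f ≡ f 0 + ∑ (upTo L) (f ∘ suc)
  ∑-upTo-suc L f = cong (λ xs → f 0 + foldr _+_ 0ℤ xs)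
    (trans (map-applyUpTo suc f L) (sym (map-applyUpTo id (f ∘ suc) L)))

  ∑-upTo-∷ʳ : ∀ L (f : ℕ → ℤ) → ∑ (upTo (suc L)) f ≡ ∑ (upTo L) f + f L
  ∑-upTo-∷ʳ L f = begin
    ∑ (upTo (suc L)) f         ≡⟨ cong (λ xs → ∑ xs f) (upTo-∷ʳ L) ⟨
    ∑ (upTo L ++ [ L ]) f      ≡⟨ ∑-++ (upTo L) [ L ] f ⟩
    ∑ (upTo L) f + (f L + 0ℤ)  ≡⟨ cong (_+_ (∑ (upTo L) f)) (+-identityʳ (f L)) ⟩
    ∑ (upTo L) f + f L         ∎
    where open ≡-Reasoning

  ∑-sublists-++ : ∀ (xs ys : List A) f → ∑ (sublists (xs ++ ys)) f ≡ ∑[ T ∈ sublists xs ] ∑[ U ∈ sublists ys ] f (T ++ U)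
  ∑-sublists-++ []       ys f = sym (+-identityʳ _)
  ∑-sublists-++ (x ∷ xs) ys f = begin
    ∑ (map (x ∷_) (sublists (xs ++ ys)) ++ sublists (xs ++ ys)) f
      ≡⟨ ∑-++ (map (x ∷_) (sublists (xs ++ ys))) _ f ⟩
    ∑ (map (x ∷_) (sublists (xs ++ ys))) f + ∑ (sublists (xs ++ ys)) f
      ≡⟨ cong₂ _+_ (trans (∑-map (x ∷_) (sublists (xs ++ ys)) f) (∑-sublists-++ xs ys (f ∘ (x ∷_)))) (∑-sublists-++ xs ys f) ⟩
    (∑[ T ∈ sublists xs ] ∑[ U ∈ sublists ys ] f (x ∷ T ++ U)) + (∑[ T ∈ sublists xs ] ∑[ U ∈ sublists ys ] f (T ++ U))
      ≡⟨ cong (λ s → s + _) (∑-map (x ∷_) (sublists xs) _) ⟨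
    (∑[ T ∈ map (x ∷_) (sublists xs) ] ∑[ U ∈ sublists ys ] f (T ++ U)) + (∑[ T ∈ sublists xs ] ∑[ U ∈ sublists ys ] f (T ++ U))
      ≡⟨ ∑-++ (map (x ∷_) (sublists xs)) (sublists xs) _ ⟨
    ∑[ T ∈ sublists (x ∷ xs) ] ∑[ U ∈ sublists ys ] f (T ++ U) ∎
    where open ≡-Reasoning

  module _ {X K : Set} (_≟_ : DecidableEquality K) (key : X → K) where

    fibre : K → List X → List X
    fibre k = filter (λ x → key x ≟ k)

    private
      ∑-fibres-singleton : ∀ {ks} x → Unique ks → key x ∈ ks → ∑[ k ∈ ks ] + length (fibre k [ x ]) ≡ 1ℤ
      ∑-fibres-singleton x u kx∈ = trans (∑-single _ u kx∈ other-fibre) (cong (+_ ∘ length) (filter-accept (λ x → key x ≟ _) refl))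
        where
        other-fibre : ∀ {k} → k ∈ _ → k ≢ key x → + length (fibre k [ x ]) ≡ 0ℤ
        other-fibre _ k≢ = cong (+_ ∘ length) (filter-reject (λ x → key x ≟ _) (k≢ ∘ sym))

    length≡∑fibres : ∀ xs {ks} → Unique ks → (∀ {x} → x ∈ xs → key x ∈ ks) →
                     + length xs ≡ ∑[ k ∈ ks ] + length (fibre k xs)
    length≡∑fibres []       {ks} u keys = sym (∑-zero ks (λ _ → refl))
    length≡∑fibres (x ∷ xs) {ks} u keys = begin
      1ℤ + + length xs
        ≡⟨ cong₂ _+_ (sym (∑-fibres-singleton x u (keys (here refl)))) (length≡∑fibres xs u (keys ∘ there)) ⟩
      (∑[ k ∈ ks ] + length (fibre k [ x ])) + (∑[ k ∈ ks ] + length (fibre k xs))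
        ≡⟨ ∑-+ ks _ _ ⟨
      ∑[ k ∈ ks ] + length (fibre k [ x ]) + + length (fibre k xs)
        ≡⟨ ∑-cong ks (λ {k} _ → trans (cong (+_ ∘ length) (filter-++ (λ x → key x ≟ k) [ x ] xs))
                                      (trans (cong +_ (length-++ (fibre k [ x ]))) (pos-+ (length (fibre k [ x ])) (length (fibre k xs))))) ⟨
      ∑[ k ∈ ks ] + length (fibre k (x ∷ xs)) ∎
      where open ≡-Reasoning

module Binomials where

  open ListFacts
  open Sums

  open import Data.Nat as ℕ using (ℕ; zero; suc; _!; _<_; s≤s)
  import Data.Nat.Properties as ℕ
  open import Data.Nat.DivMod using (m*n/n≡m; m*n%n≡0)
  open import Data.Integer as ℤ using (ℤ; +_; -[1+_]; 0ℤ; 1ℤ; _+_; _*_; _-_; -_)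
  open import Data.Integer.Properties
  open import Data.Integer.Solver using (module +-*-Solver)
  open +-*-Solver

  falling-pascal : ∀ y j → falling (1ℤ + y) (suc j) ≡ falling y (suc j) + + suc j * falling y j
  falling-pascal y zero    = solve 1 (λ y → con 1ℤ :* ((con 1ℤ :+ y) :- con 0ℤ) := con 1ℤ :* (y :- con 0ℤ) :+ con 1ℤ :* con 1ℤ) refl y
  falling-pascal y (suc j) = begin
    falling (1ℤ + y) (suc j) * (1ℤ + y - + suc j)
      ≡⟨ cong (_* (1ℤ + y - + suc j)) (falling-pascal y j) ⟩
    (falling y (suc j) + + suc j * falling y j) * (1ℤ + y - (1ℤ + + j))
      ≡⟨ solve 3 (λ y f k → (f :* (y :- k) :+ (con 1ℤ :+ k) :* f) :* (con 1ℤ :+ y :- (con 1ℤ :+ k))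
                          := f :* (y :- k) :* (y :- (con 1ℤ :+ k)) :+ (con 1ℤ :+ (con 1ℤ :+ k)) :* (f :* (y :- k)))
               refl y (falling y j) (+ j) ⟩
    falling y (suc j) * (y - + suc j) + + suc (suc j) * falling y (suc j) ∎
    where open ≡-Reasoning

  [q*d]/ℕd≡q : ∀ q d .{{_ : ℕ.NonZero d}} → (q * + d) ℤ./ℕ d ≡ q
  [q*d]/ℕd≡q (+ a)    (suc d) = trans (cong (ℤ._/ℕ suc d) (sym (pos-* a (suc d)))) (cong +_ (m*n/n≡m a (suc d)))
  [q*d]/ℕd≡q -[1+ a ] (suc d) = exact (m*n%n≡0 (suc a) (suc d))
    where
    exact : suc (d ℕ.+ a ℕ.* suc d) ℕ.% suc d ≡ 0 → (-[1+ a ] * + suc d) ℤ./ℕ suc d ≡ -[1+ a ]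
    exact rem≡0 with suc (d ℕ.+ a ℕ.* suc d) ℕ.% suc d
    ... | zero = cong (λ x → - (+ x)) (m*n/n≡m (suc a) (suc d))

  private
    FactorialDivides : ℕ → ℤ → Set
    FactorialDivides j y = ∃[ q ] falling y j ≡ q * + (j !)

    falling-0-suc : ∀ k → falling 0ℤ (suc k) ≡ 0ℤ
    falling-0-suc zero    = refl
    falling-0-suc (suc k) = trans (cong (_* (0ℤ - + suc k)) (falling-0-suc k)) (*-zeroˡ (0ℤ - + suc k))

    pascal-step : ∀ y j {q₀} → falling y j ≡ q₀ * + (j !) →
                  falling (1ℤ + y) (suc j) ≡ falling y (suc j) + q₀ * + (suc j !)
    pascal-step y j {q₀} eq = begin
      falling (1ℤ + y) (suc j)                        ≡⟨ falling-pascal y j ⟩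
      falling y (suc j) + + suc j * falling y j       ≡⟨ cong (λ f → falling y (suc j) + + suc j * f) eq ⟩
      falling y (suc j) + + suc j * (q₀ * + (j !))    ≡⟨ solve 4 (λ g k q f → g :+ k :* (q :* f) := g :+ q :* (k :* f))
                                                           refl (falling y (suc j)) (+ suc j) q₀ (+ (j !)) ⟩
      falling y (suc j) + q₀ * (+ suc j * + (j !))    ≡⟨ cong (λ f → falling y (suc j) + q₀ * f) (pos-* (suc j) (j !)) ⟨
      falling y (suc j) + q₀ * + (suc j !)            ∎
      where open ≡-Reasoning

    -- Pascal's rule for falling factorials carries divisibility by j! from y = 0 upwards and downwards.
    factorial-divides-falling : ∀ j y → FactorialDivides j y
    factorial-divides-falling zero    y = 1ℤ , refl
    factorial-divides-falling (suc j) y = divides y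
      where
      F = + (suc j !)

      upward : ∀ {y} → FactorialDivides (suc j) y → FactorialDivides (suc j) (1ℤ + y)
      upward {y} (q , eq) with factorial-divides-falling j y
      ... | q₀ , eq₀ = q + q₀ , trans (pascal-step y j {q₀} eq₀)
        (trans (cong (_+ q₀ * F) eq) (sym (*-distribʳ-+ F q q₀)))

      downward : ∀ {y} → FactorialDivides (suc j) (1ℤ + y) → FactorialDivides (suc j) y
      downward {y} (q , eq) with factorial-divides-falling j y
      ... | q₀ , eq₀ = q - q₀ , (begin
        falling y (suc j)                          ≡⟨ solve 2 (λ g c → g := g :+ c :- c) refl (falling y (suc j)) (q₀ * F) ⟩
        falling y (suc j) + q₀ * F - q₀ * F        ≡⟨ cong (_- q₀ * F) (trans (sym (pascal-step y j {q₀} eq₀)) eq) ⟩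
        q * F - q₀ * F                             ≡⟨ solve 3 (λ q q₀ f → q :* f :- q₀ :* f := (q :- q₀) :* f) refl q q₀ F ⟩
        (q - q₀) * F                               ∎)
        where open ≡-Reasoning

      at-zero : FactorialDivides (suc j) 0ℤ
      at-zero = 0ℤ , falling-0-suc j

      divides-pos : ∀ a → FactorialDivides (suc j) (+ a)
      divides-pos zero    = at-zero
      divides-pos (suc a) = upward (divides-pos a)

      divides-neg : ∀ a → FactorialDivides (suc j) -[1+ a ]
      divides-neg zero    = downward at-zero
      divides-neg (suc a) = downward (divides-neg a)

      divides : ∀ y → FactorialDivides (suc j) y
      divides (+ a)    = divides-pos a
      divides -[1+ a ] = divides-neg a

    binomℤ-exact : ∀ y j {q} → falling y j ≡ q * + (j !) → binomℤ y j ≡ q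
    binomℤ-exact y j {q} eq =
      trans (cong (λ f → (f ℤ./ℕ (j !)) {{j ℕ.!≢0}}) eq) ([q*d]/ℕd≡q q (j !) {{j ℕ.!≢0}})

  binomℤ-0 : ∀ y → binomℤ y 0 ≡ 1ℤ
  binomℤ-0 y = binomℤ-exact y 0 refl

  binomℤ-0-suc : ∀ j → binomℤ 0ℤ (suc j) ≡ 0ℤ
  binomℤ-0-suc j = binomℤ-exact 0ℤ (suc j) (trans (falling-0-suc j) (sym (*-zeroˡ (+ (suc j !)))))

  binomℤ-pascal : ∀ y j → binomℤ (1ℤ + y) (suc j) ≡ binomℤ y (suc j) + binomℤ y j
  binomℤ-pascal y j with factorial-divides-falling (suc j) y | factorial-divides-falling j y
  ... | q₁ , eq₁ | q₀ , eq₀ = begin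
    binomℤ (1ℤ + y) (suc j)             ≡⟨ binomℤ-exact (1ℤ + y) (suc j) {q₁ + q₀} falling≡ ⟩
    q₁ + q₀                             ≡⟨ cong₂ _+_ (binomℤ-exact y (suc j) {q₁} eq₁) (binomℤ-exact y j {q₀} eq₀) ⟨
    binomℤ y (suc j) + binomℤ y j       ∎
    where
    open ≡-Reasoning
    F = + (suc j !)
    falling≡ : falling (1ℤ + y) (suc j) ≡ (q₁ + q₀) * F
    falling≡ = trans (pascal-step y j {q₀} eq₀) (trans (cong (_+ q₀ * F) eq₁) (sym (*-distribʳ-+ F q₁ q₀)))

  module BinomialTransform (M : ℕ) (φ : ℕ → ℤ) (φ-vanishes : ∀ k → M < k → φ k ≡ 0ℤ) where

    term : ℕ → ℤ → ℕ → ℤ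
    term s y j = φ (s ℕ.+ j) * binomℤ y j

    Φ : ℕ → ℤ → ℤ
    Φ s y = ∑ (upTo (suc M)) (term s y)

    Φ-0 : ∀ s → Φ s 0ℤ ≡ φ s
    Φ-0 s = begin
      Φ s 0ℤ
        ≡⟨ ∑-upTo-suc M (term s 0ℤ) ⟩
      φ (s ℕ.+ 0) * binomℤ 0ℤ 0 + (∑[ j ∈ upTo M ] φ (s ℕ.+ suc j) * binomℤ 0ℤ (suc j))
        ≡⟨ cong₂ _+_ (cong₂ _*_ (cong φ (ℕ.+-identityʳ s)) (binomℤ-0 0ℤ))
                     (∑-zero (upTo M) (λ {j} _ → trans (cong (φ (s ℕ.+ suc j) *_) (binomℤ-0-suc j)) (*-zeroʳ (φ (s ℕ.+ suc j))))) ⟩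
      φ s * 1ℤ + 0ℤ
        ≡⟨ trans (+-identityʳ _) (*-identityʳ (φ s)) ⟩
      φ s ∎
      where open ≡-Reasoning

    Φ-pascal : ∀ s y → Φ s (1ℤ + y) ≡ Φ s y + Φ (suc s) y
    Φ-pascal s y = begin
      Φ s (1ℤ + y)
        ≡⟨ ∑-upTo-suc M (term s (1ℤ + y)) ⟩
      a 0 * binomℤ (1ℤ + y) 0 + (∑[ j ∈ upTo M ] a (suc j) * binomℤ (1ℤ + y) (suc j))
        ≡⟨ cong₂ _+_ (cong (a 0 *_) (trans (binomℤ-0 (1ℤ + y)) (sym (binomℤ-0 y))))
                     (∑-cong (upTo M) (λ {j} _ → trans (cong (a (suc j) *_) (binomℤ-pascal y j)) (*-distribˡ-+ (a (suc j)) (binomℤ y (suc j)) (binomℤ y j)))) ⟩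
      a 0 * binomℤ y 0 + (∑[ j ∈ upTo M ] a (suc j) * binomℤ y (suc j) + a (suc j) * binomℤ y j)
        ≡⟨ cong (_+_ (a 0 * binomℤ y 0)) (∑-+ (upTo M) (λ j → a (suc j) * binomℤ y (suc j)) (λ j → a (suc j) * binomℤ y j)) ⟩
      a 0 * binomℤ y 0 + ((∑[ j ∈ upTo M ] a (suc j) * binomℤ y (suc j)) + (∑[ j ∈ upTo M ] a (suc j) * binomℤ y j))
        ≡⟨ +-assoc (a 0 * binomℤ y 0) (∑[ j ∈ upTo M ] a (suc j) * binomℤ y (suc j)) (∑[ j ∈ upTo M ] a (suc j) * binomℤ y j) ⟨
      a 0 * binomℤ y 0 + (∑[ j ∈ upTo M ] a (suc j) * binomℤ y (suc j)) + (∑[ j ∈ upTo M ] a (suc j) * binomℤ y j)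
        ≡⟨ cong₂ _+_ (∑-upTo-suc M (term s y)) shifted ⟨
      Φ s y + Φ (suc s) y ∎
      where
      open ≡-Reasoning
      a : ℕ → ℤ
      a j = φ (s ℕ.+ j)
      shifted : Φ (suc s) y ≡ ∑[ j ∈ upTo M ] a (suc j) * binomℤ y j
      shifted = begin
        Φ (suc s) y
          ≡⟨ ∑-upTo-∷ʳ M (term (suc s) y) ⟩
        (∑[ j ∈ upTo M ] φ (suc s ℕ.+ j) * binomℤ y j) + φ (suc s ℕ.+ M) * binomℤ y M
          ≡⟨ cong₂ _+_ (∑-cong (upTo M) (λ {j} _ → cong (λ k → φ k * binomℤ y j) (sym (ℕ.+-suc s j))))
                       (trans (cong (_* binomℤ y M) (φ-vanishes _ (s≤s (ℕ.m≤n+m M s)))) (*-zeroˡ (binomℤ y M))) ⟩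
        (∑[ j ∈ upTo M ] a (suc j) * binomℤ y j) + 0ℤ
          ≡⟨ +-identityʳ _ ⟩
        ∑[ j ∈ upTo M ] a (suc j) * binomℤ y j ∎

    ∑-sublists-Φ : ∀ {X : Set} (A : List X) s y → ∑[ T ∈ sublists A ] Φ (s ℕ.+ length T) y ≡ Φ s (y + + length A)
    ∑-sublists-Φ []      s y = trans (+-identityʳ _) (cong₂ Φ (ℕ.+-identityʳ s) (sym (+-identityʳ y)))
    ∑-sublists-Φ (x ∷ A) s y = begin
      ∑[ T ∈ map (x ∷_) (sublists A) ++ sublists A ] Φ (s ℕ.+ length T) y
        ≡⟨ ∑-++ (map (x ∷_) (sublists A)) (sublists A) _ ⟩
      (∑[ T ∈ map (x ∷_) (sublists A) ] Φ (s ℕ.+ length T) y) + (∑[ T ∈ sublists A ] Φ (s ℕ.+ length T) y)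
        ≡⟨ cong (_+ _) (trans (∑-map (x ∷_) (sublists A) _) (∑-cong (sublists A) (λ {T} _ → cong (λ k → Φ k y) (ℕ.+-suc s (length T))))) ⟩
      (∑[ T ∈ sublists A ] Φ (suc s ℕ.+ length T) y) + (∑[ T ∈ sublists A ] Φ (s ℕ.+ length T) y)
        ≡⟨ cong₂ _+_ (∑-sublists-Φ A (suc s) y) (∑-sublists-Φ A s y) ⟩
      Φ (suc s) (y + + length A) + Φ s (y + + length A)
        ≡⟨ trans (+-comm (Φ (suc s) (y + + length A)) _) (sym (Φ-pascal s (y + + length A))) ⟩
      Φ s (1ℤ + (y + + length A))
        ≡⟨ cong (Φ s) (solve 2 (λ y l → con 1ℤ :+ (y :+ l) := y :+ (con 1ℤ :+ l)) refl y (+ length A)) ⟩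
      Φ s (y + + suc (length A)) ∎
      where open ≡-Reasoning

module Inversions where

  open Intervals
  open Positions

  open import Data.Nat using (ℕ; suc; _≤_; _<_; _≤?_; _<?_; _⊔_; _≡ᵇ_; z≤n; s≤s)
  open import Data.Nat.Properties
  open import Data.Bool using (true; false; T)
  open import Data.List.Properties using (length-++)
  open import Data.List.Membership.Propositional using (find; lose)

  record HPair (h : ℕ → ℕ) (n i j : ℕ) : Set where
    constructor hpair
    field
      1≤i : 1 ≤ i
      i<j : i < j
      j≤n : j ≤ n
      j≤h : j ≤ h i

  Inversion : (ℕ → ℕ) → List ℕ → ℕ → ℕ → Set
  Inversion h π i j = HPair h (length π) i j × at π j < at π i

  record InversionSet (h : ℕ → ℕ) (π : List ℕ) (S : List (ℕ × ℕ)) : Set where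
    field
      S⇒inversion : ∀ {i j} → (i , j) ∈ S → Inversion h π i j
      inversion⇒S : ∀ {i j} → Inversion h π i j → (i , j) ∈ S

  private
    pairsFrom : (ℕ → ℕ) → ℕ → ℕ → List (ℕ × ℕ)
    pairsFrom h n i = map (i ,_) (filter (λ j → j ≤? h i) (interval (suc i) n))

  ∈-pairsUpTo⁺ : ∀ h n {i j} → HPair h n i j → (i , j) ∈ pairsUpTo h n
  ∈-pairsUpTo⁺ h n (hpair 1≤i i<j j≤n j≤h) = ∈-concatMap⁺ (pairsFrom h n) {xs = interval 1 n}
    (lose (∈-interval⁺ 1≤i (≤-trans (<⇒≤ i<j) j≤n))
          (∈-map⁺ (_ ,_) (∈-filter⁺ (λ j → j ≤? h _) (∈-interval⁺ i<j j≤n) j≤h)))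

  ∈-pairsUpTo⁻ : ∀ h n {i j} → (i , j) ∈ pairsUpTo h n → HPair h n i j
  ∈-pairsUpTo⁻ h n p with find (∈-concatMap⁻ (pairsFrom h n) {xs = interval 1 n} p)
  ... | i , i∈ , q with ∈-map⁻ (i ,_) q
  ... | j , j∈ , refl with ∈-filter⁻ (λ j → j ≤? h i) j∈
  ... | j∈′ , j≤h = hpair (proj₁ (∈-interval⁻ i∈)) (proj₁ (∈-interval⁻ j∈′)) (proj₂ (∈-interval⁻ j∈′)) j≤h

  ∈-invList⁺ : ∀ h π {i j} → Inversion h π i j → (i , j) ∈ invList h π
  ∈-invList⁺ h π (p , lt) = ∈-filter⁺ (λ p → at π (proj₂ p) <? at π (proj₁ p)) (∈-pairsUpTo⁺ h (length π) p) lt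

  ∈-invList⁻ : ∀ h π {i j} → (i , j) ∈ invList h π → Inversion h π i j
  ∈-invList⁻ h π ij∈ with ∈-filter⁻ (λ p → at π (proj₂ p) <? at π (proj₁ p)) ij∈
  ... | ij∈′ , lt = ∈-pairsUpTo⁻ h (length π) ij∈′ , lt

  sameSet⇒inversionSet : ∀ h π S → SameSet ≟ℕ×ℕ (invList h π) S → InversionSet h π S
  sameSet⇒inversionSet h π S (inv⊆S , S⊆inv) = record
    { S⇒inversion = ∈-invList⁻ h π ∘ All.lookup S⊆inv ; inversion⇒S = All.lookup inv⊆S ∘ ∈-invList⁺ h π }

  inversionSet⇒sameSet : ∀ h π S → InversionSet h π S → SameSet ≟ℕ×ℕ (invList h π) S
  inversionSet⇒sameSet h π S inv =
    All.tabulate (inversion⇒S ∘ ∈-invList⁻ h π) , All.tabulate (∈-invList⁺ h π ∘ S⇒inversion)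
    where open InversionSet inv

  descent : ∀ π {i j} → i < j → at π j < at π i → ∃[ k ] (i ≤ k × k < j × at π (suc k) < at π k)
  descent π {i} {suc j} (s≤s i≤j) lt with m≤n⇒m<n∨m≡n i≤j
  ... | inj₂ refl = i , ≤-refl , ≤-refl , lt
  ... | inj₁ i<j with at π j <? at π i
  ...   | yes lt′ = let k , i≤k , k<j , desc = descent π i<j lt′ in k , i≤k , m≤n⇒m≤1+n k<j , desc
  ...   | no  nlt = j , i≤j , ≤-refl , <-≤-trans lt (≮⇒≥ nlt)

  mS-upper : ∀ S {k} → (k , suc k) ∈ S → k ≤ mS S
  mS-upper ((a , b) ∷ S) (here refl) with suc a ≡ᵇ suc a in eq
  ... | true  = m≤m⊔n a _
  ... | false = ⊥-elim (subst T eq (≡⇒≡ᵇ (suc a) (suc a) refl))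
  mS-upper ((a , b) ∷ S) (there k∈) with b ≡ᵇ suc a
  ... | true  = ≤-trans (mS-upper S k∈) (m≤n⊔m a _)
  ... | false = mS-upper S k∈

  mS-attained : ∀ S → mS S ≡ 0 ⊎ (mS S , suc (mS S)) ∈ S
  mS-attained [] = inj₁ refl
  mS-attained ((a , b) ∷ S) with b ≡ᵇ suc a in eq
  ... | false = map₂ there (mS-attained S)
  ... | true with ≤-total (mS S) a
  ...   | inj₁ m≤a rewrite m≥n⇒m⊔n≡m m≤a | ≡ᵇ⇒≡ b (suc a) (subst T (sym eq) _) = inj₂ (here refl)
  ...   | inj₂ a≤m rewrite m≤n⇒m⊔n≡n a≤m = map₂ there (mS-attained S)

  jS-upper : ∀ S {i j} → (i , j) ∈ S → j ≤ jS S
  jS-upper ((a , b) ∷ S) (here refl) = m≤m⊔n b _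
  jS-upper ((a , b) ∷ S) (there p)   = ≤-trans (jS-upper S p) (m≤n⊔m b _)

  jS-least : ∀ S {c} → (∀ {i j} → (i , j) ∈ S → j ≤ c) → jS S ≤ c
  jS-least []            _ = z≤n
  jS-least ((a , b) ∷ S) f = ⊔-lub (f (here refl)) (jS-least S (f ∘ there))

  inversion-++⁺ : ∀ {h} π ys {i j} → j ≤ length π → Inversion h π i j → Inversion h (π ++ ys) i j
  inversion-++⁺ π ys j≤ (hpair 1≤i i<j _ j≤h , lt) =
    hpair 1≤i i<j (≤-trans j≤ (≤-trans (m≤m+n (length π) (length ys)) (≤-reflexive (sym (length-++ π))))) j≤h ,
    subst₂ _<_ (sym (at-++ˡ π ys (≤-trans 1≤i (<⇒≤ i<j)) j≤)) (sym (at-++ˡ π ys 1≤i (≤-trans (<⇒≤ i<j) j≤))) lt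

  inversion-++⁻ : ∀ {h} π ys {i j} → j ≤ length π → Inversion h (π ++ ys) i j → Inversion h π i j
  inversion-++⁻ π ys j≤ (hpair 1≤i i<j _ j≤h , lt) =
    hpair 1≤i i<j j≤ j≤h ,
    subst₂ _<_ (at-++ˡ π ys (≤-trans 1≤i (<⇒≤ i<j)) j≤) (at-++ˡ π ys 1≤i (≤-trans (<⇒≤ i<j) j≤)) lt

module Transposition where

  open ListFacts

  open import Data.Nat using (ℕ; suc; _≤_; _<_)
  open import Data.Nat.Properties

  transpose : ℕ → ℕ → ℕ
  transpose v u with u ≟ v | u ≟ suc v
  ... | yes _ | _     = suc v
  ... | no  _ | yes _ = v
  ... | no  _ | no  _ = u

  data Transposed (v u : ℕ) : ℕ → Set where
    lower : u ≡ v → Transposed v u (suc v)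
    upper : u ≡ suc v → Transposed v u v
    other : u ≢ v → u ≢ suc v → Transposed v u u

  transposed : ∀ v u → Transposed v u (transpose v u)
  transposed v u with u ≟ v | u ≟ suc v
  ... | yes u≡v | _        = lower u≡v
  ... | no  u≢v | yes u≡sv = upper u≡sv
  ... | no  u≢v | no  u≢sv = other u≢v u≢sv

  transpose-lower : ∀ v → transpose v v ≡ suc v
  transpose-lower v with transpose v v | transposed v v
  ... | _ | lower _       = refl
  ... | _ | upper v≡sv    = ⊥-elim (1+n≢n (sym v≡sv))
  ... | _ | other v≢v _   = ⊥-elim (v≢v refl)

  transpose-upper : ∀ v → transpose v (suc v) ≡ v
  transpose-upper v with transpose v (suc v) | transposed v (suc v)
  ... | _ | lower sv≡v    = ⊥-elim (1+n≢n sv≡v)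
  ... | _ | upper _       = refl
  ... | _ | other _ sv≢sv = ⊥-elim (sv≢sv refl)

  transpose-involutive : ∀ v u → transpose v (transpose v u) ≡ u
  transpose-involutive v u with transpose v u | transposed v u
  ... | _ | lower refl         = transpose-upper v
  ... | _ | upper refl         = transpose-lower v
  ... | _ | other u≢v u≢sv with transpose v u | transposed v u
  ...   | _ | lower u≡v  = ⊥-elim (u≢v u≡v)
  ...   | _ | upper u≡sv = ⊥-elim (u≢sv u≡sv)
  ...   | _ | other _ _  = refl

  transpose-injective : ∀ v {x y} → transpose v x ≡ transpose v y → x ≡ y
  transpose-injective v {x} {y} eq =
    trans (sym (transpose-involutive v x)) (trans (cong (transpose v) eq) (transpose-involutive v y))

  transpose-monotone : ∀ v {a b} → a < b → ¬ (a ≡ v × b ≡ suc v) → transpose v a < transpose v b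
  transpose-monotone v {a} {b} a<b ¬adjacent with transpose v a | transposed v a | transpose v b | transposed v b
  ... | _ | lower refl       | _ | lower refl       = ⊥-elim (<-irrefl refl a<b)
  ... | _ | lower refl       | _ | upper refl       = ⊥-elim (¬adjacent (refl , refl))
  ... | _ | lower refl       | _ | other _ b≢sv     = ≤∧≢⇒< a<b (b≢sv ∘ sym)
  ... | _ | upper refl       | _ | lower refl       = ⊥-elim (<-asym a<b (n<1+n v))
  ... | _ | upper refl       | _ | upper refl       = ⊥-elim (<-irrefl refl a<b)
  ... | _ | upper refl       | _ | other _ _        = <-trans (n<1+n v) a<b
  ... | _ | other _ _        | _ | lower refl       = <-trans a<b (n<1+n v)
  ... | _ | other a≢v _      | _ | upper refl       = ≤∧≢⇒< (≤-pred a<b) a≢v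
  ... | _ | other _ _        | _ | other _ _        = a<b

  transpose-bounded : ∀ {v lo hi u} → lo ≤ v → suc v ≤ hi → lo ≤ u → u ≤ hi → lo ≤ transpose v u × transpose v u ≤ hi
  transpose-bounded {v} {u = u} lo≤v sv≤hi lo≤u u≤hi with transpose v u | transposed v u
  ... | _ | lower _   = ≤-trans lo≤v (n≤1+n v) , sv≤hi
  ... | _ | upper _   = lo≤v , ≤-trans (n≤1+n v) sv≤hi
  ... | _ | other _ _ = lo≤u , u≤hi

  map-transpose-involutive : ∀ v xs → map (transpose v) (map (transpose v) xs) ≡ xs
  map-transpose-involutive v []       = refl
  map-transpose-involutive v (x ∷ xs) = cong₂ _∷_ (transpose-involutive v x) (map-transpose-involutive v xs)

  ∈-map-transpose⁻ : ∀ v {u xs} → u ∈ map (transpose v) xs → transpose v u ∈ xs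
  ∈-map-transpose⁻ v u∈ with ∈-map⁻ (transpose v) u∈
  ... | x , x∈ , refl = subst (_∈ _) (sym (transpose-involutive v x)) x∈

  ∈-map-transpose⁺ : ∀ v {u xs} → transpose v u ∈ xs → u ∈ map (transpose v) xs
  ∈-map-transpose⁺ v {u} tu∈ = subst (_∈ _) (transpose-involutive v u) (∈-map⁺ (transpose v) tu∈)

  ∈-replace : ∀ {v u} xs ys → v ∉ xs ++ ys → suc v ∉ xs ++ ys →
              (u ∈ xs ++ v ∷ ys → transpose v u ∈ xs ++ suc v ∷ ys) × (transpose v u ∈ xs ++ suc v ∷ ys → u ∈ xs ++ v ∷ ys)
  ∈-replace {v} {u} xs ys v∉ sv∉ with transpose v u | transposed v u
  ... | _ | lower refl         = (λ _ → ∈-insert xs) , (λ _ → ∈-insert xs)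
  ... | _ | upper refl         = ⊥-elim ∘ sv∉ ∘ ∈-insert-≢ xs ys 1+n≢n , ⊥-elim ∘ v∉ ∘ ∈-insert-≢ xs ys (1+n≢n ∘ sym)
  ... | _ | other u≢v u≢sv     = ∈-insert⁺ xs ys ∘ ∈-insert-≢ xs ys u≢v , ∈-insert⁺ xs ys ∘ ∈-insert-≢ xs ys u≢sv

module AdmissibleSet (h : ℕ → ℕ) (h-mono : WeaklyIncreasing h) (h-above : AboveDiagonal h)
                     (S : List (ℕ × ℕ)) (S≢[] : S ≢ []) (adm : Admissible h S) where

  open ListFacts
  open Intervals
  open Positions
  open Permutations
  open Sums
  open Binomials
  open Inversions
  open Transposition

  open import Data.Nat using (ℕ; zero; suc; _+_; _∸_; _≤_; _<_; _≤′_; ≤′-refl; ≤′-step; _≤?_; _<?_; _⊓_; z≤n; s≤s)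
  open import Data.Nat.Properties
  open import Data.Integer as ℤ using (ℤ; +_; 0ℤ)
  import Data.Integer.Properties as ℤP
  open import Data.Integer.Solver using (module +-*-Solver)
  open import Data.List.Properties
    using (≡-dec; length-take; length-map; length-++; take-map; take-all; ++-identityʳ; ++-assoc; filter-all; filter-none)
  import Data.List.Membership.DecPropositional as DecMembership
  import Data.List.Relation.Unary.AllPairs.Properties as AllPairsP
  open import Relation.Binary using (DecidableEquality)
  open import Relation.Nullary.Decidable using (_×-dec_)

  m H J G : ℕ
  m = mS S
  H = h m
  J = jS S
  G = suc J ⊓ H

  private
    π₀ : List ℕ
    π₀ = proj₁ (proj₂ adm)

    open InversionSet (sameSet⇒inversionSet h π₀ S (proj₂ (proj₂ (proj₂ adm))))
      renaming (S⇒inversion to S⇒inversion₀; inversion⇒S to inversion⇒S₀)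

  pair-bounds : ∀ {i j} → (i , j) ∈ S → 1 ≤ i × i < j × j ≤ h i
  pair-bounds ij∈ = let hpair 1≤i i<j _ j≤h , _ = S⇒inversion₀ ij∈ in 1≤i , i<j , j≤h

  adjacent-pair-after : ∀ {i j} → (i , j) ∈ S → ∃[ k ] (i ≤ k × 1 ≤ k × (k , suc k) ∈ S)
  adjacent-pair-after ij∈ with S⇒inversion₀ ij∈
  ... | hpair 1≤i i<j j≤n j≤h , lt with descent π₀ i<j lt
  ... | k , i≤k , k<j , desc = k , i≤k , 1≤k ,
        inversion⇒S₀ (hpair 1≤k ≤-refl (≤-trans k<j j≤n) (h-above k 1≤k) , desc)
    where 1≤k = ≤-trans 1≤i i≤k

  first≤m : ∀ {i j} → (i , j) ∈ S → i ≤ m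
  first≤m ij∈ = let k , i≤k , _ , k∈ = adjacent-pair-after ij∈ in ≤-trans i≤k (mS-upper S k∈)

  1≤m : 1 ≤ m
  1≤m = let _ , ij∈ = ≢[]⇒∃∈ S S≢[] ; k , _ , 1≤k , k∈ = adjacent-pair-after ij∈ in ≤-trans 1≤k (mS-upper S k∈)

  m∈S : (m , suc m) ∈ S
  m∈S = [ (λ m≡0 → ⊥-elim (<⇒≢ 1≤m (sym m≡0))) , id ]′ (mS-attained S)

  m<J : m < J
  m<J = jS-upper S m∈S

  m<H : m < H
  m<H = h-above m 1≤m

  J≤H : J ≤ H
  J≤H = jS-least S λ ij∈ → let 1≤i , _ , j≤h = pair-bounds ij∈ in ≤-trans j≤h (h-mono 1≤i (first≤m ij∈))

  <G : ∀ {v} → v ≤ J → v < H → v < G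
  <G v≤J v<H = ⊓-glb (s≤s v≤J) v<H

  G≤H : G ≤ H
  G≤H = m⊓n≤n (suc J) H

  G≤1+J : G ≤ suc J
  G≤1+J = m⊓n≤m (suc J) H

  1≤G : 1 ≤ G
  1≤G = <G z≤n (≤-trans (s≤s z≤n) m<H)

  Member : ℕ → List ℕ → Set
  Member n π = π ∈ Sym n × InversionSet h π S

  module MemberFacts {n π} (mem : Member n π) where
    open IsPermutation (∈Sym⇒isPermutation n (proj₁ mem)) public
    open InversionSet (proj₂ mem) public

    length≡n : length π ≡ n
    length≡n = length-∈Sym n (proj₁ mem)

    m<length : m < length π
    m<length = HPair.j≤n (proj₁ (S⇒inversion m∈S))

    at-bounded : ∀ {p} → 1 ≤ p → p ≤ length π → 1 ≤ at π p × at π p ≤ n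
    at-bounded 1≤p p≤ = bounded (at-∈ π 1≤p p≤)

    at-distinct : ∀ {i j} → 1 ≤ i → i < j → j ≤ length π → at π i ≢ at π j
    at-distinct 1≤i i<j j≤ eq =
      <⇒≢ i<j (at-injective π unique 1≤i (≤-trans (<⇒≤ i<j) j≤) (≤-trans 1≤i (<⇒≤ i<j)) j≤ eq)

    ascending-step : ∀ {p} → m < p → suc p ≤ length π → at π p < at π (suc p)
    ascending-step {p} m<p sp≤ with at π (suc p) <? at π p
    ... | yes desc = ⊥-elim (<⇒≱ m<p (first≤m (inversion⇒S (hpair 1≤p ≤-refl sp≤ (h-above p 1≤p) , desc))))
      where 1≤p = ≤-trans 1≤m (<⇒≤ m<p)
    ... | no ¬desc = ≤∧≢⇒< (≮⇒≥ ¬desc) (at-distinct (≤-trans 1≤m (<⇒≤ m<p)) ≤-refl sp≤)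

    ascending-after-m : ∀ {p q} → m < p → p < q → q ≤ length π → at π p < at π q
    ascending-after-m {p} {suc q} m<p (s≤s p≤q) q≤ with m≤n⇒m<n∨m≡n p≤q
    ... | inj₂ refl = ascending-step m<p q≤
    ... | inj₁ p<q  = <-trans (ascending-after-m m<p p<q (≤-trans (n≤1+n q) q≤)) (ascending-step (<-trans m<p p<q) q≤)

    occurs-before : ∀ {j u} → m < suc j → suc j ≤ length π → 1 ≤ u → u < at π (suc j) → u ∈ take j π
    occurs-before {j} {u} m<j j≤ 1≤u u< with ∈⇒at π (complete 1≤u (≤-trans (<⇒≤ u<) (proj₂ (at-bounded (s≤s z≤n) j≤))))
    ... | p , 1≤p , p≤ , at≡u with p ≤? j
    ...   | yes p≤j = subst (_∈ take j π) at≡u (∈-take⁺ j π 1≤p p≤j p≤)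
    ...   | no  p≰j with m≤n⇒m<n∨m≡n (≰⇒> p≰j)
    ...     | inj₂ refl = ⊥-elim (<-irrefl (sym at≡u) u<)
    ...     | inj₁ j<p  = ⊥-elim (<-asym u< (subst (at π (suc j) <_) at≡u (ascending-after-m m<j j<p p≤)))

    private
      count-before : ∀ {j} {xs : List ℕ} → Unique xs → xs ⊆ take j π → length xs ≤ j
      count-before {j} u xs⊆ = ≤-trans (⊆⇒length≤ u xs⊆) (≤-trans (≤-reflexive (length-take j π)) (m⊓n≤m j (length π)))

    inverted-value< : ∀ {i j} → 1 ≤ i → i ≤ m → m < suc j → suc j ≤ length π →
                      at π (suc j) < at π i → at π (suc j) < suc j
    inverted-value< {i} {j} 1≤i i≤m m<j j≤ v<w = s≤s (subst (_≤ j) length≡v (count-before unique-xs xs⊆))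
      where
      v = at π (suc j)
      1≤v = proj₁ (at-bounded (s≤s z≤n) j≤)
      xs = at π i ∷ range 1 (v ∸ 1)
      length≡v : length xs ≡ v
      length≡v = trans (cong suc (length-range 1 (v ∸ 1))) (m+[n∸m]≡n 1≤v)
      below-v : ∀ {u} → u ∈ range 1 (v ∸ 1) → 1 ≤ u × u < v
      below-v u∈ = let 1≤u , u< = ∈-range⁻ u∈ in 1≤u , subst (_ <_) (m+[n∸m]≡n 1≤v) u<
      unique-xs : Unique xs
      unique-xs = All.tabulate (λ u∈ w≡u → <-asym v<w (subst (_< v) (sym w≡u) (proj₂ (below-v u∈))))
                  ∷ ascending⇒unique (range-ascending 1 (v ∸ 1))
      xs⊆ : xs ⊆ take j π
      xs⊆ (here refl) = ∈-take⁺ j π 1≤i (≤-pred (≤-<-trans i≤m m<j)) (≤-trans (<⇒≤ (≤-<-trans i≤m m<j)) j≤)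
      xs⊆ (there u∈)  = uncurry (occurs-before m<j j≤) (below-v u∈)

    non-inverted-value< : ∀ {i j} → i ≤ m → m < suc j → suc j ≤ length π →
                          at π i < at π (suc j) → at π i < suc j
    non-inverted-value< {i} {j} i≤m m<j j≤ w<v =
      s≤s (subst (_≤ j) (length-range 1 (at π i)) (count-before (ascending⇒unique (range-ascending 1 (at π i))) below))
      where
      below : range 1 (at π i) ⊆ take j π
      below u∈ = let 1≤u , u< = ∈-range⁻ u∈ in occurs-before m<j j≤ 1≤u (≤-<-trans (≤-pred u<) w<v)

    head-value≤J : ∀ {i j} → 1 ≤ i → i ≤ m → m < j → j ≤ length π → j ≤ h i → at π i < at π j → at π i ≤ J
    head-value≤J {j = zero} _ _ () _ _ _
    head-value≤J {i} {suc j} 1≤i i≤m (s≤s m≤j) j≤ j≤h w<v with m≤n⇒m<n∨m≡n m≤j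
    ... | inj₂ refl = ≤-trans (≤-pred (non-inverted-value< i≤m (s≤s m≤j) j≤ w<v)) (<⇒≤ m<J)
    ... | inj₁ m<j with at π i <? at π j
    ...   | yes w<πj = head-value≤J 1≤i i≤m m<j (≤-trans (n≤1+n j) j≤) (≤-trans (n≤1+n j) j≤h) w<πj
    ...   | no  w≮πj = ≤-trans (≤-pred (non-inverted-value< i≤m (s≤s m≤j) j≤ w<v)) (jS-upper S (inversion⇒S ij-inversion))
      where
      i<j = ≤-<-trans i≤m m<j
      ij-inversion : Inversion h π i j
      ij-inversion = hpair 1≤i i<j (≤-trans (n≤1+n j) j≤) (≤-trans (n≤1+n j) j≤h) ,
                     ≤∧≢⇒< (≮⇒≥ w≮πj) (at-distinct 1≤i i<j (≤-trans (n≤1+n j) j≤) ∘ sym)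

    tail-value<G : ∀ {i j} → 1 ≤ i → i ≤ m → m < j → j ≤ length π → j ≤ h i → G ≤ at π i → at π j < G
    tail-value<G {j = zero} _ _ () _ _ _
    tail-value<G {i} {suc j} 1≤i i≤m m<j j≤ j≤h G≤w with at π (suc j) <? at π i
    ... | yes v<w = <G (≤-trans (<⇒≤ v<j) (jS-upper S (inversion⇒S (hpair 1≤i (≤-<-trans i≤m m<j) j≤ j≤h , v<w))))
                       (<-≤-trans v<j (≤-trans j≤h (h-mono 1≤i i≤m)))
      where v<j = inverted-value< 1≤i i≤m m<j j≤ v<w
    ... | no  v≮w = ⊥-elim (<⇒≱ (<G (head-value≤J 1≤i i≤m m<j j≤ j≤h w<v)
                                     (<-≤-trans (non-inverted-value< i≤m m<j j≤ w<v) (≤-trans j≤h (h-mono 1≤i i≤m))))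
                                 G≤w)
      where w<v = ≤∧≢⇒< (≮⇒≥ v≮w) (at-distinct 1≤i (≤-<-trans i≤m m<j) j≤)

  Straddle : ℕ → ℕ → ℕ → Set
  Straddle v a b = (a ≡ v × b ≡ suc v) ⊎ (a ≡ suc v × b ≡ v)

  private
    straddle-elim : ∀ {P : ℕ → Set} {v a b} → Straddle v a b → P a → P b → P v × P (suc v)
    straddle-elim (inj₁ (refl , refl)) pa pb = pa , pb
    straddle-elim (inj₂ (refl , refl)) pa pb = pb , pa

    straddle-intro : ∀ {P : ℕ → Set} {v a b} → Straddle v a b → P v → P (suc v) → P a × P b
    straddle-intro (inj₁ (refl , refl)) pv psv = pv , psv
    straddle-intro (inj₂ (refl , refl)) pv psv = psv , pv

  ExactlyOne : ℕ → List ℕ → Set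
  ExactlyOne v xs = (v ∈ xs × suc v ∉ xs) ⊎ (v ∉ xs × suc v ∈ xs)

  module TransposeValues {n π} (mem : Member n π) {v} (G≤v : G ≤ v) (v<n : suc v ≤ n)
                         (one : ExactlyOne v (take m π)) where
    open MemberFacts {n} mem

    private
      head = take m π

      not-both : v ∈ head → suc v ∈ head → ⊥
      not-both v∈ sv∈ = [ (λ (_ , sv∉) → sv∉ sv∈) , (λ (v∉ , _) → v∉ v∈) ]′ one

      not-neither : v ∉ head → suc v ∉ head → ⊥
      not-neither v∉ sv∉ = [ (λ (v∈ , _) → v∉ v∈) , (λ (_ , sv∈) → sv∉ sv∈) ]′ one

      in-head : ∀ {p} → 1 ≤ p → p ≤ m → p ≤ length π → at π p ∈ head
      in-head = ∈-take⁺ m π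

      not-in-head : ∀ {p} → m < p → p ≤ length π → at π p ∉ head
      not-in-head m<p p≤ p∈ with ∈-take⁻ m π p∈
      ... | q , 1≤q , q≤m , q≤ , at≡ = <⇒≢ (≤-<-trans q≤m m<p) (at-injective π unique 1≤q q≤ (≤-trans 1≤m (<⇒≤ m<p)) p≤ at≡)

    -- Both in the head or both in the tail contradicts ExactlyOne; head and tail is ruled out by tail-value<G.
    no-straddle : ∀ {i j} → HPair h (length π) i j → ¬ Straddle v (at π i) (at π j)
    no-straddle {i} {j} (hpair 1≤i i<j j≤ j≤h) st with i ≤? m | j ≤? m
    ... | yes i≤m | yes j≤m = uncurry not-both
          (straddle-elim {P = _∈ head} st (in-head 1≤i i≤m (≤-trans (<⇒≤ i<j) j≤)) (in-head (≤-trans 1≤i (<⇒≤ i<j)) j≤m j≤))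
    ... | yes i≤m | no  j≰m = <⇒≱ (tail-value<G 1≤i i≤m (≰⇒> j≰m) j≤ j≤h G≤πi) G≤πj
          where G≤πi×πj = straddle-intro {P = G ≤_} st G≤v (≤-trans G≤v (n≤1+n v))
                G≤πi = proj₁ G≤πi×πj
                G≤πj = proj₂ G≤πi×πj
    ... | no  i≰m | _       = uncurry not-neither
          (straddle-elim {P = _∉ head} st (not-in-head (≰⇒> i≰m) (≤-trans (<⇒≤ i<j) j≤)) (not-in-head (<-trans (≰⇒> i≰m) i<j) j≤))

    π′ : List ℕ
    π′ = map (transpose v) π

    private
      length-π′ : length π′ ≡ length π
      length-π′ = length-map (transpose v) π

      at-π′ : ∀ {p} → 1 ≤ p → p ≤ length π → at π′ p ≡ transpose v (at π p)
      at-π′ = at-map (transpose v) π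

      1≤v = ≤-trans 1≤G G≤v

      transpose-preserves : ∀ {i j} → HPair h (length π) i j → at π j < at π i → at π′ j < at π′ i
      transpose-preserves p@(hpair 1≤i i<j j≤ _) lt =
        subst₂ _<_ (sym (at-π′ (≤-trans 1≤i (<⇒≤ i<j)) j≤)) (sym (at-π′ 1≤i (≤-trans (<⇒≤ i<j) j≤)))
          (transpose-monotone v lt (λ (πj≡v , πi≡sv) → no-straddle p (inj₂ (πi≡sv , πj≡v))))

      transpose-reflects : ∀ {i j} → HPair h (length π) i j → at π′ j < at π′ i → at π j < at π i
      transpose-reflects {i} {j} p@(hpair 1≤i i<j j≤ _) lt′ with at π j <? at π i
      ... | yes lt = lt
      ... | no ¬lt = ⊥-elim (<-asym lt′
            (subst₂ _<_ (sym (at-π′ 1≤i (≤-trans (<⇒≤ i<j) j≤))) (sym (at-π′ (≤-trans 1≤i (<⇒≤ i<j)) j≤))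
              (transpose-monotone v (≤∧≢⇒< (≮⇒≥ ¬lt) (at-distinct 1≤i i<j j≤)) (no-straddle p ∘ inj₁))))

      resize : ∀ {i j} → HPair h (length π′) i j → HPair h (length π) i j
      resize (hpair 1≤i i<j j≤ j≤h) = hpair 1≤i i<j (subst (_ ≤_) length-π′ j≤) j≤h

    transpose-member : Member n π′
    transpose-member = isPermutation⇒∈Sym n permutation , record
      { S⇒inversion = λ ij∈ → let p , lt = S⇒inversion ij∈ in resize⁻¹ p , transpose-preserves p lt
      ; inversion⇒S = λ (p , lt′) → inversion⇒S (resize p , transpose-reflects (resize p) lt′)
      }
      where
      resize⁻¹ : ∀ {i j} → HPair h (length π) i j → HPair h (length π′) i j
      resize⁻¹ (hpair 1≤i i<j j≤ j≤h) = hpair 1≤i i<j (subst (_ ≤_) (sym length-π′) j≤) j≤h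
      permutation : IsPermutation n π′
      permutation = record
        { unique   = Unique.map⁺ (transpose-injective v) unique
        ; bounded  = λ u∈ → let x , x∈ , u≡ = ∈-map⁻ (transpose v) u∈ in
                     subst (λ u → 1 ≤ u × u ≤ n) (sym u≡) (uncurry (transpose-bounded 1≤v v<n) (bounded x∈))
        ; complete = λ {u} 1≤u u≤n → subst (_∈ π′) (transpose-involutive v u)
                     (∈-map⁺ (transpose v) (uncurry complete (transpose-bounded 1≤v v<n 1≤u u≤n)))
        }

  open DecMembership _≟_ using (_∈?_)

  _≟L_ : DecidableEquality (List ℕ)
  _≟L_ = ≡-dec _≟_

  I : ℕ → List ℕ
  I n = interval G n

  headValues : ℕ → List ℕ → List ℕ
  headValues n π = filter (_∈? take m π) (I n)

  count : ℕ → List ℕ → ℕ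
  count n T = length (fibre _≟L_ (headValues n) T (Ilist h S n))

  ∈Ilist⁻ : ∀ n {π} → π ∈ Ilist h S n → Member n π
  ∈Ilist⁻ n {π} π∈ = let π∈Sym , same = ∈-filter⁻ (λ π → sameSet? ≟ℕ×ℕ (invList h π) S) {xs = Sym n} π∈
                       in π∈Sym , sameSet⇒inversionSet h π S same

  ∈Ilist⁺ : ∀ n {π} → Member n π → π ∈ Ilist h S n
  ∈Ilist⁺ n {π} (π∈Sym , inv) = ∈-filter⁺ (λ π → sameSet? ≟ℕ×ℕ (invList h π) S) π∈Sym (inversionSet⇒sameSet h π S inv)

  Ilist-unique : ∀ n → Unique (Ilist h S n)
  Ilist-unique n = Unique.filter⁺ (λ π → sameSet? ≟ℕ×ℕ (invList h π) S)
                     (perms-unique (interval 1 n) (ascending⇒unique (interval-ascending 1 n)))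

  ∈headValues⁻ : ∀ {n π u} → u ∈ headValues n π → u ∈ I n × u ∈ take m π
  ∈headValues⁻ {n} {π} = ∈-filter⁻ (_∈? take m π) {xs = I n}

  headValues-≡ : ∀ {n π T} → Ascending T → T ⊆ I n →
                 (∀ {u} → u ∈ I n → u ∈ take m π → u ∈ T) → (∀ {u} → u ∈ T → u ∈ take m π) →
                 headValues n π ≡ T
  headValues-≡ {n} {π} ↑T T⊆I head⊆T T⊆head = ascending-≡
    (AllPairsP.filter⁺ (_∈? take m π) (interval-ascending G n)) ↑T
    (uncurry head⊆T ∘ ∈headValues⁻) (λ u∈T → ∈-filter⁺ (_∈? take m π) (T⊆I u∈T) (T⊆head u∈T))

  headValues-agree : ∀ {n π T u} → headValues n π ≡ T → u ∈ I n → (u ∈ take m π → u ∈ T) × (u ∈ T → u ∈ take m π)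
  headValues-agree {n} {π} refl u∈I = ∈-filter⁺ (_∈? take m π) u∈I , proj₂ ∘ ∈headValues⁻

  private
    transpose-∈I : ∀ {n v u} → G ≤ v → suc v ≤ n → u ∈ I n → transpose v u ∈ I n
    transpose-∈I G≤v v<n u∈I = uncurry ∈-interval⁺ (uncurry (transpose-bounded G≤v v<n) (∈-interval⁻ u∈I))

    transpose-fibre : ∀ {n π v T₁ T₂} → G ≤ v → suc v ≤ n → Member n π → headValues n π ≡ T₁ → ExactlyOne v T₁ →
                      Ascending T₂ → T₂ ⊆ I n →
                      (∀ {u} → u ∈ I n → (u ∈ T₂ → transpose v u ∈ T₁) × (transpose v u ∈ T₁ → u ∈ T₂)) →
                      Member n (map (transpose v) π) × headValues n (map (transpose v) π) ≡ T₂
    transpose-fibre {n} {π} {v} {T₁} {T₂} G≤v v<n mem head≡ one ↑T₂ T₂⊆I T₂⇔T₁ =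
      TransposeValues.transpose-member mem G≤v v<n one′ , headValues-≡ ↑T₂ T₂⊆I head′⊆T₂ T₂⊆head′
      where
      v∈I  = ∈-interval⁺ G≤v (≤-trans (n≤1+n v) v<n)
      sv∈I = ∈-interval⁺ (≤-trans G≤v (n≤1+n v)) v<n
      one′ : ExactlyOne v (take m π)
      one′ = [ (λ (v∈ , sv∉) → inj₁ (proj₂ (headValues-agree head≡ v∈I) v∈ , sv∉ ∘ proj₁ (headValues-agree head≡ sv∈I))) ,
               (λ (v∉ , sv∈) → inj₂ (v∉ ∘ proj₁ (headValues-agree head≡ v∈I) , proj₂ (headValues-agree head≡ sv∈I) sv∈)) ]′ one
      head′⊆T₂ : ∀ {u} → u ∈ I n → u ∈ take m (map (transpose v) π) → u ∈ T₂
      head′⊆T₂ u∈I u∈ = proj₂ (T₂⇔T₁ u∈I) (proj₁ (headValues-agree head≡ (transpose-∈I G≤v v<n u∈I))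
                          (∈-map-transpose⁻ v (subst (_ ∈_) (take-map m π) u∈)))
      T₂⊆head′ : ∀ {u} → u ∈ T₂ → u ∈ take m (map (transpose v) π)
      T₂⊆head′ u∈ = subst (_ ∈_) (sym (take-map m π)) (∈-map-transpose⁺ v
                      (proj₂ (headValues-agree head≡ (transpose-∈I G≤v v<n (T₂⊆I u∈))) (proj₁ (T₂⇔T₁ (T₂⊆I u∈)) u∈)))

  -- The involution `map (transpose v)` on one-line notations exchanges the two fibres.
  swap-count : ∀ {n v} xs ys → G ≤ v → suc v ≤ n → v ∉ xs ++ ys → suc v ∉ xs ++ ys → xs ++ ys ⊆ I n →
               Ascending (xs ++ suc v ∷ ys) → Ascending (xs ++ v ∷ ys) →
               count n (xs ++ suc v ∷ ys) ≡ count n (xs ++ v ∷ ys)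
  swap-count {n} {v} xs ys G≤v v<n v∉ sv∉ ⊆I ↑T₁ ↑T₂ =
    length-filter-bijection (λ π → headValues n π ≟L T₁) (λ π → headValues n π ≟L T₂)
      (map (transpose v)) (map (transpose v)) (Ilist-unique n) (Ilist-unique n)
      (λ π∈ head≡ → let mem′ , head≡′ = transpose-fibre G≤v v<n (∈Ilist⁻ n π∈) head≡ (inj₂ (v∉T₁ , sv∈T₁)) ↑T₂ (T⊆I v∈I) T₂⇔T₁
                    in ∈Ilist⁺ n mem′ , head≡′)
      (λ π∈ head≡ → let mem′ , head≡′ = transpose-fibre G≤v v<n (∈Ilist⁻ n π∈) head≡ (inj₁ (∈-insert xs , sv∉T₂)) ↑T₁ (T⊆I sv∈I) T₁⇔T₂
                    in ∈Ilist⁺ n mem′ , head≡′)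
      (λ {π} _ _ → map-transpose-involutive v π) (λ {π} _ _ → map-transpose-involutive v π)
    where
    T₁ = xs ++ suc v ∷ ys
    T₂ = xs ++ v ∷ ys
    v∈I  = ∈-interval⁺ G≤v (≤-trans (n≤1+n v) v<n)
    sv∈I = ∈-interval⁺ (≤-trans G≤v (n≤1+n v)) v<n
    T⊆I : ∀ {x} → x ∈ I n → xs ++ x ∷ ys ⊆ I n
    T⊆I x∈I u∈ = [ (λ { refl → x∈I }) , ⊆I ]′ (∈-insert⁻ xs ys u∈)
    v∉T₁ : v ∉ T₁
    v∉T₁ = v∉ ∘ ∈-insert-≢ xs ys (1+n≢n ∘ sym)
    sv∈T₁ : suc v ∈ T₁
    sv∈T₁ = ∈-insert xs
    sv∉T₂ : suc v ∉ T₂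
    sv∉T₂ = sv∉ ∘ ∈-insert-≢ xs ys 1+n≢n
    T₂⇔T₁ : ∀ {u} → u ∈ I n → (u ∈ T₂ → transpose v u ∈ T₁) × (transpose v u ∈ T₁ → u ∈ T₂)
    T₂⇔T₁ _ = ∈-replace xs ys v∉ sv∉
    T₁⇔T₂ : ∀ {u} → u ∈ I n → (u ∈ T₁ → transpose v u ∈ T₂) × (transpose v u ∈ T₂ → u ∈ T₁)
    T₁⇔T₂ {u} _ = let to , from = ∈-replace {u = transpose v u} xs ys v∉ sv∉
                      invol = transpose-involutive v u
                  in from ∘ subst (_∈ T₁) (sym invol) , subst (_∈ T₁) invol ∘ to

  private
    ascending-prefix : ∀ ℓ {x T} → G + ℓ ≤ x → All (x <_) T → Ascending T → Ascending (range G ℓ ++ x ∷ T)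
    ascending-prefix ℓ G+ℓ≤x x< ↑T = AllPairsP.++⁺ (range-ascending G ℓ) (x< ∷ ↑T)
      (All.tabulate λ u∈ → All.tabulate λ where
        (here refl) → <-≤-trans (proj₂ (∈-range⁻ u∈)) G+ℓ≤x
        (there w∈)  → <-trans (<-≤-trans (proj₂ (∈-range⁻ u∈)) G+ℓ≤x) (All.lookup x< w∈))

    slide : ∀ {n} ℓ t {T} → G + ℓ ≤ t → t ≤ n → All (t <_) T → All (_≤ n) T → Ascending T →
            count n (range G ℓ ++ t ∷ T) ≡ count n (range G ℓ ++ (G + ℓ) ∷ T)
    slide ℓ t G+ℓ≤t t≤n t< ≤n ↑T with m≤n⇒m<n∨m≡n G+ℓ≤t
    ... | inj₂ refl = refl
    slide {n} ℓ (suc t) {T} G+ℓ≤t t≤n t< ≤n ↑T | inj₁ (s≤s G+ℓ≤t′) =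
      trans (swap-count (range G ℓ) T G≤t t≤n t∉ st∉ ⊆I (ascending-prefix ℓ G+ℓ≤t t< ↑T) (ascending-prefix ℓ G+ℓ≤t′ t′< ↑T))
            (slide ℓ t G+ℓ≤t′ (≤-trans (n≤1+n t) t≤n) t′< ≤n ↑T)
      where
      G≤t = ≤-trans (m≤m+n G ℓ) G+ℓ≤t′
      t′< : All (t <_) T
      t′< = All.map (<-trans (n<1+n t)) t<
      below : ∀ {u} → u ∈ range G ℓ → u < t
      below u∈ = <-≤-trans (proj₂ (∈-range⁻ u∈)) G+ℓ≤t′
      t∉ : t ∉ range G ℓ ++ T
      t∉ t∈ = [ (λ t∈ → <-irrefl refl (below t∈)) , (λ t∈ → <-asym (n<1+n t) (All.lookup t< t∈)) ]′ (∈-++⁻ (range G ℓ) t∈)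
      st∉ : suc t ∉ range G ℓ ++ T
      st∉ st∈ = [ (λ st∈ → <-asym (n<1+n t) (below st∈)) , (λ st∈ → <-irrefl refl (All.lookup t< st∈)) ]′ (∈-++⁻ (range G ℓ) st∈)
      ⊆I : range G ℓ ++ T ⊆ I n
      ⊆I u∈ = [ (λ u∈ → ∈-interval⁺ (proj₁ (∈-range⁻ u∈)) (≤-trans (<⇒≤ (below u∈)) (≤-trans (n≤1+n t) t≤n))) ,
                (λ u∈ → ∈-interval⁺ (≤-trans G≤t (<⇒≤ (<-trans (n<1+n t) (All.lookup t< u∈)))) (All.lookup ≤n u∈)) ]′
              (∈-++⁻ (range G ℓ) u∈)

    compress : ∀ {n} ℓ T → Ascending T → All (λ u → G + ℓ ≤ u × u ≤ n) T →
               count n (range G ℓ ++ T) ≡ count n (range G (ℓ + length T))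
    compress {n} ℓ []      _          _ = cong (count n) (trans (++-identityʳ (range G ℓ)) (cong (range G) (sym (+-identityʳ ℓ))))
    compress {n} ℓ (t ∷ T) (t< ∷ ↑T) ((G+ℓ≤t , t≤n) ∷ bounds) = begin
      count n (range G ℓ ++ t ∷ T)              ≡⟨ slide ℓ t G+ℓ≤t t≤n t< (All.map proj₂ bounds) ↑T ⟩
      count n (range G ℓ ++ (G + ℓ) ∷ T)        ≡⟨ cong (count n) (++-assoc (range G ℓ) [ G + ℓ ] T) ⟨
      count n ((range G ℓ ++ [ G + ℓ ]) ++ T)   ≡⟨ cong (λ xs → count n (xs ++ T)) (range-∷ʳ G ℓ) ⟩
      count n (range G (suc ℓ) ++ T)            ≡⟨ compress (suc ℓ) T ↑T bounds′ ⟩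
      count n (range G (suc ℓ + length T))      ≡⟨ cong (count n ∘ range G) (+-suc ℓ (length T)) ⟨
      count n (range G (ℓ + suc (length T)))    ∎
      where
      open ≡-Reasoning
      bounds′ : All (λ u → G + suc ℓ ≤ u × u ≤ n) T
      bounds′ = All.zipWith (λ {u} (t<u , (_ , u≤n)) → subst (_≤ u) (sym (+-suc G ℓ)) (≤-<-trans G+ℓ≤t t<u) , u≤n) (t< , bounds)

  count-standard : ∀ {n T} → T ∈ sublists (I n) → count n T ≡ count n (range G (length T))
  count-standard {n} {T} T∈ = compress 0 T (ascending-sublist (interval-ascending G n) T∈)
    (All.tabulate λ {u} u∈ → let G≤u , u≤n = ∈-interval⁻ (sublist⇒⊆ T∈ u∈) in subst (_≤ u) (sym (+-identityʳ G)) G≤u , u≤n)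

  Icount≡∑count : ∀ n → + Icount h S n ≡ ∑[ T ∈ sublists (I n) ] + count n T
  Icount≡∑count n = length≡∑fibres _≟L_ (headValues n) (Ilist h S n)
    (sublists-unique (ascending⇒unique (interval-ascending G n))) (λ {π} _ → filter∈sublists (_∈? take m π) (I n))

  count-vanishes : ∀ n {T} → Unique T → m < length T → count n T ≡ 0
  count-vanishes n {T} u m<|T| = cong length (filter-none (λ π → headValues n π ≟L T) (All.tabulate too-many))
    where
    too-many : ∀ {π} → π ∈ Ilist h S n → headValues n π ≢ T
    too-many {π} _ refl = <⇒≱ m<|T| (≤-trans (⊆⇒length≤ u (proj₂ ∘ ∈headValues⁻))
                                             (≤-trans (≤-reflexive (length-take m π)) (m⊓n≤m m (length π))))

  private
    append-member : ∀ {n π} → Member n π → Member (suc n) (π ++ [ suc n ])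
    append-member {n} {π} mem = isPermutation⇒∈Sym (suc n) (isPermutation-∷ʳ (∈Sym⇒isPermutation n (proj₁ mem))) , record
      { S⇒inversion = λ ij∈ → let inv = S⇒inversion ij∈ in inversion-++⁺ π [ suc n ] (HPair.j≤n (proj₁ inv)) inv
      ; inversion⇒S = λ {i} {j} inv → inversion⇒S (inversion-++⁻ π [ suc n ] (j≤length inv) inv)
      }
      where
      open MemberFacts {n} mem
      j≤length : ∀ {i j} → Inversion h (π ++ [ suc n ]) i j → j ≤ length π
      j≤length {i} {j} (hpair 1≤i i<j j≤ _ , lt) with m≤n⇒m<n∨m≡n (subst (j ≤_) (trans (length-++ π) (+-comm (length π) 1)) j≤)
      ... | inj₁ j<sl = ≤-pred j<sl
      ... | inj₂ refl = ⊥-elim (<⇒≱ lt (subst₂ _≤_ (sym (at-++ˡ π _ 1≤i i≤)) (sym (at-∷ʳ π (suc n)))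
                                  (m≤n⇒m≤1+n (proj₂ (at-bounded 1≤i i≤)))))
        where i≤ = ≤-pred i<j

    drop-member : ∀ {n π} → J ≤ n → Member (suc n) (π ++ [ suc n ]) → Member n π
    drop-member {n} {π} J≤n mem′ = isPermutation⇒∈Sym n (isPermutation-∷ʳ⁻ (∈Sym⇒isPermutation (suc n) (proj₁ mem′))) , record
      { S⇒inversion = λ ij∈ → inversion-++⁻ π [ suc n ] (j≤length ij∈) (S⇒inversion ij∈)
      ; inversion⇒S = λ inv → inversion⇒S (inversion-++⁺ π [ suc n ] (HPair.j≤n (proj₁ inv)) inv)
      }
      where
      open MemberFacts {suc n} mem′
      j≤length : ∀ {i j} → (i , j) ∈ S → j ≤ length π
      j≤length ij∈ = ≤-trans (jS-upper S ij∈) (subst (J ≤_)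
        (sym (suc-injective (trans (+-comm 1 (length π)) (trans (sym (length-++ π)) length≡n)))) J≤n)

    headValues-append : ∀ {n π} → Member n π → headValues (suc n) (π ++ [ suc n ]) ≡ headValues n π
    headValues-append {n} {π} mem =
      headValues-≡ (AllPairsP.filter⁺ (_∈? take m π) (interval-ascending G n)) (widen ∘ proj₁ ∘ ∈headValues⁻) head⊆ ⊆head
      where
      open MemberFacts {n} mem
      take≡ : take m (π ++ [ suc n ]) ≡ take m π
      take≡ = take-++ˡ m π [ suc n ] (<⇒≤ m<length)
      widen : I n ⊆ I (suc n)
      widen u∈ = let G≤u , u≤n = ∈-interval⁻ u∈ in ∈-interval⁺ G≤u (m≤n⇒m≤1+n u≤n)
      head⊆ : ∀ {u} → u ∈ I (suc n) → u ∈ take m (π ++ [ suc n ]) → u ∈ headValues n π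
      head⊆ u∈I u∈ = let u∈′ = subst (_ ∈_) take≡ u∈ in
        ∈-filter⁺ (_∈? take m π) (∈-interval⁺ (proj₁ (∈-interval⁻ u∈I)) (proj₂ (bounded (∈-take⇒∈ m π u∈′)))) u∈′
      ⊆head : ∀ {u} → u ∈ headValues n π → u ∈ take m (π ++ [ suc n ])
      ⊆head u∈ = subst (_ ∈_) (sym take≡) (proj₂ (∈headValues⁻ u∈))

    last-is-max : ∀ {n π′} → Member (suc n) π′ → suc n ∉ take m π′ → π′ ≡ take n π′ ++ [ suc n ]
    last-is-max {n} {π′} mem′ sn∉head = ∷ʳ-take n π′ (suc n) length≡n at-last
      where
      open MemberFacts {suc n} mem′
      last-position = ≤-reflexive (sym length≡n)
      at-last : at π′ (suc n) ≡ suc n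
      at-last with ∈⇒at π′ (complete (s≤s z≤n) ≤-refl)
      ... | p , 1≤p , p≤ , at≡ with p ≤? m
      ...   | yes p≤m = ⊥-elim (sn∉head (subst (_∈ take m π′) at≡ (∈-take⁺ m π′ 1≤p p≤m p≤)))
      ...   | no  p≰m with m≤n⇒m<n∨m≡n (subst (p ≤_) length≡n p≤)
      ...     | inj₂ refl = at≡
      ...     | inj₁ p<sn = ⊥-elim (<⇒≱ (subst (_< at π′ (suc n)) at≡ (ascending-after-m (≰⇒> p≰m) p<sn last-position))
                                        (proj₂ (at-bounded (s≤s z≤n) last-position)))

  -- Appending the new largest value n + 1 is a bijection between the two fibres.
  count-extend : ∀ {n R} → J ≤ n → suc n ∉ R → count n R ≡ count (suc n) R
  count-extend {n} {R} J≤n sn∉R =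
    length-filter-bijection (λ π → headValues n π ≟L R) (λ π → headValues (suc n) π ≟L R)
      (_++ [ suc n ]) (take n) (Ilist-unique n) (Ilist-unique (suc n))
      (λ π∈ head≡ → let mem = ∈Ilist⁻ n π∈ in ∈Ilist⁺ (suc n) (append-member mem) , trans (headValues-append mem) head≡)
      (λ {π′} π′∈ head≡ → let mem = drop-member J≤n (subst (Member (suc n)) (split π′∈ head≡) (∈Ilist⁻ (suc n) π′∈)) in
                          ∈Ilist⁺ n mem , trans (sym (headValues-append mem)) (trans (cong (headValues (suc n)) (sym (split π′∈ head≡))) head≡))
      (λ {π} π∈ _ → let len = MemberFacts.length≡n {n} (∈Ilist⁻ n π∈) in
                    trans (take-++ˡ n π [ suc n ] (≤-reflexive (sym len))) (take-all n π (≤-reflexive len)))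
      (λ π′∈ head≡ → sym (split π′∈ head≡))
    where
    sn∈I : suc n ∈ I (suc n)
    sn∈I = ∈-interval⁺ (≤-trans G≤1+J (s≤s J≤n)) ≤-refl
    split : ∀ {π′} → π′ ∈ Ilist h S (suc n) → headValues (suc n) π′ ≡ R → π′ ≡ take n π′ ++ [ suc n ]
    split {π′} π′∈ head≡ = last-is-max (∈Ilist⁻ (suc n) π′∈)
      (λ sn∈ → sn∉R (subst (suc n ∈_) head≡ (∈-filter⁺ (_∈? take m π′) sn∈I sn∈)))

  N : ℕ
  N = m + H ∸ 1

  1+N≡H+m : suc N ≡ H + m
  1+N≡H+m = trans (m+[n∸m]≡n (≤-trans (≤-trans (s≤s z≤n) m<H) (m≤n+m H m))) (+-comm m H)

  J≤N : J ≤ N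
  J≤N = ≤-trans J≤H (≤-pred (subst (H <_) (sym 1+N≡H+m) (subst (_≤ H + m) (+-comm H 1) (+-monoʳ-≤ H 1≤m))))

  φ : ℕ → ℤ
  φ k = + count N (range G k)

  φ-vanishes : ∀ k → m < k → φ k ≡ 0ℤ
  φ-vanishes k m<k = cong +_ (count-vanishes N (ascending⇒unique (range-ascending G k)) (subst (m <_) (sym (length-range G k)) m<k))

  private
    count-shift : ∀ {n n′ k} → J ≤ n → n ≤′ n′ → G + k ≤ suc n → count n (range G k) ≡ count n′ (range G k)
    count-shift J≤n ≤′-refl         _       = refl
    count-shift J≤n (≤′-step n≤′n′) G+k≤1+n = trans (count-shift J≤n n≤′n′ G+k≤1+n)
      (count-extend (≤-trans J≤n (≤′⇒≤ n≤′n′)) λ sn∈ → <⇒≱ (proj₂ (∈-range⁻ sn∈)) (≤-trans G+k≤1+n (s≤s (≤′⇒≤ n≤′n′))))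

  count≡φ : ∀ {n k} → J ≤ n → G + k ≤ suc n → + count n (range G k) ≡ φ k
  count≡φ {n} {k} J≤n G+k≤1+n with k ≤? m
  ... | no  k≰m = trans (cong +_ (count-vanishes n (ascending⇒unique (range-ascending G k)) (subst (m <_) (sym (length-range G k)) (≰⇒> k≰m)))) (sym (φ-vanishes k (≰⇒> k≰m)))
  ... | yes k≤m = cong +_ ([ (λ n≤N → count-shift J≤n (≤⇒≤′ n≤N) G+k≤1+n) ,
                             (λ N≤n → sym (count-shift J≤N (≤⇒≤′ N≤n) G+k≤1+N)) ]′ (≤-total n N))
    where G+k≤1+N = subst (G + k ≤_) (sym 1+N≡H+m) (+-mono-≤ G≤H k≤m)

  open BinomialTransform m φ φ-vanishes public

  Icount≡Φ : ∀ {n} → J ≤ n → + Icount h S n ≡ Φ 0 (0ℤ ℤ.+ + length (I n))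
  Icount≡Φ {n} J≤n = begin
    + Icount h S n                                ≡⟨ Icount≡∑count n ⟩
    ∑[ T ∈ sublists (I n) ] + count n T           ≡⟨ ∑-cong (sublists (I n)) (λ T∈ → trans (cong +_ (count-standard T∈)) (count≡φ J≤n (fits T∈))) ⟩
    ∑[ T ∈ sublists (I n) ] φ (length T)          ≡⟨ ∑-cong (sublists (I n)) (λ {T} _ → sym (Φ-0 (length T))) ⟩
    ∑[ T ∈ sublists (I n) ] Φ (0 + length T) 0ℤ   ≡⟨ ∑-sublists-Φ (I n) 0 0ℤ ⟩
    Φ 0 (0ℤ ℤ.+ + length (I n))                   ∎
    where
    open ≡-Reasoning
    fits : ∀ {T} → T ∈ sublists (I n) → G + length T ≤ suc n
    fits T∈ = ≤-trans (+-monoʳ-≤ G (subst (_ ≤_) (length-range G (suc n ∸ G)) (length-sublist {xs = I n} T∈)))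
                      (≤-reflexive (m+[n∸m]≡n (≤-trans G≤1+J (s≤s J≤n))))

  A B : List ℕ
  A = range G (H ∸ G)
  B = range H m

  private
    -- The condition in Defs.aCoeff, so that aCoeff unfolds to a filter by window?.
    inWindow? : (v : ℕ) → Dec (H ≤ v × v ≤ N)
    inWindow? v = H ≤? v ×-dec v ≤? N

    Window : ℕ → List ℕ → Set
    Window k xs = SameSet _≟_ (filter inWindow? xs) (range H k)

    window? : ∀ k xs → Dec (Window k xs)
    window? k xs = sameSet? _≟_ (filter inWindow? xs) (range H k)

    G+[H∸G]≡H : G + (H ∸ G) ≡ H
    G+[H∸G]≡H = m+[n∸m]≡n G≤H

    I≡A++B : I N ≡ A ++ B
    I≡A++B = ascending-≡ (interval-ascending G N) ↑A++B I⊆ ⊆I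
      where
      ↑A++B : Ascending (A ++ B)
      ↑A++B = AllPairsP.++⁺ (range-ascending G (H ∸ G)) (range-ascending H m)
        (All.tabulate λ x∈ → All.tabulate λ y∈ → <-≤-trans (subst (_ <_) G+[H∸G]≡H (proj₂ (∈-range⁻ x∈))) (proj₁ (∈-range⁻ y∈)))
      I⊆ : I N ⊆ A ++ B
      I⊆ {u} u∈ with ∈-interval⁻ u∈ | u <? H
      ... | G≤u , _   | yes u<H = ∈-++⁺ˡ (∈-range⁺ G≤u (subst (u <_) (sym G+[H∸G]≡H) u<H))
      ... | _   , u≤N | no  u≮H = ∈-++⁺ʳ A (∈-range⁺ (≮⇒≥ u≮H) (subst (u <_) 1+N≡H+m (s≤s u≤N)))
      ⊆I : A ++ B ⊆ I N
      ⊆I {u} u∈ = [ (λ u∈A → let G≤u , u< = ∈-range⁻ u∈A in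
                                ∈-interval⁺ G≤u (≤-pred (≤-trans (subst (u <_) G+[H∸G]≡H u<) (≤-trans (m≤m+n H m) (≤-reflexive (sym 1+N≡H+m)))))) ,
                    (λ u∈B → let H≤u , u< = ∈-range⁻ u∈B in
                                ∈-interval⁺ (≤-trans G≤H H≤u) (≤-pred (subst (u <_) (sym 1+N≡H+m) u<))) ]′ (∈-++⁻ A u∈)

    window-transfer : ∀ {k π T} → headValues N π ≡ T → (Window k (take m π) → Window k T) × (Window k T → Window k (take m π))
    window-transfer {k} {π} {T} head≡ = sameSet-resp _≟_ to from , sameSet-resp _≟_ from to
      where
      inI : ∀ {u} → H ≤ u × u ≤ N → u ∈ I N
      inI (H≤u , u≤N) = ∈-interval⁺ (≤-trans G≤H H≤u) u≤N
      to : filter inWindow? (take m π) ⊆ filter inWindow? T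
      to u∈ = let u∈head , win = ∈-filter⁻ inWindow? {xs = take m π} u∈ in
              ∈-filter⁺ inWindow? (proj₁ (headValues-agree head≡ (inI win)) u∈head) win
      from : filter inWindow? T ⊆ filter inWindow? (take m π)
      from u∈ = let u∈T , win = ∈-filter⁻ inWindow? {xs = T} u∈ in
                ∈-filter⁺ inWindow? (proj₂ (headValues-agree head≡ (inI win)) u∈T) win

    window-split : ∀ {TA TB} → TA ∈ sublists A → TB ∈ sublists B →
                   filter inWindow? (TA ++ TB) ⊆ TB × TB ⊆ filter inWindow? (TA ++ TB)
    window-split {TA} {TB} TA∈ TB∈ = to , from
      where
      to : filter inWindow? (TA ++ TB) ⊆ TB
      to u∈ with ∈-filter⁻ inWindow? {xs = TA ++ TB} u∈
      ... | u∈TA++TB , H≤u , _ = [ (λ u∈TA → ⊥-elim (<⇒≱ (subst (_ <_) G+[H∸G]≡H (proj₂ (∈-range⁻ (sublist⇒⊆ {xs = A} TA∈ u∈TA)))) H≤u)) ,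
                                    id ]′ (∈-++⁻ TA u∈TA++TB)
      from : TB ⊆ filter inWindow? (TA ++ TB)
      from {u} u∈ = let H≤u , u< = ∈-range⁻ (sublist⇒⊆ {xs = B} TB∈ u∈) in
                ∈-filter⁺ inWindow? (∈-++⁺ʳ TA u∈) (H≤u , ≤-pred (subst (u <_) (sym 1+N≡H+m) u<))

    range∈sublists : ∀ {k} → k ≤ m → range H k ∈ sublists B
    range∈sublists k≤m = ascending-⊆⇒∈sublists (range-ascending H m) (range-ascending H _)
      (λ u∈ → let H≤u , u< = ∈-range⁻ u∈ in ∈-range⁺ H≤u (<-≤-trans u< (+-monoʳ-≤ H k≤m)))

    window⇒range : ∀ {k TA TB} → TA ∈ sublists A → TB ∈ sublists B → Window k (TA ++ TB) → TB ≡ range H k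
    window⇒range {k} TA∈ TB∈ w = let filter⊆ , ⊆filter = sameSet⁻ _≟_ w ; to , from = window-split TA∈ TB∈ in
      ascending-≡ (ascending-sublist (range-ascending H m) TB∈) (range-ascending H k) (filter⊆ ∘ from) (to ∘ ⊆filter)

    range⇒window : ∀ {k TA} → k ≤ m → TA ∈ sublists A → Window k (TA ++ range H k)
    range⇒window {k} k≤m TA∈ = let to , from = window-split TA∈ (range∈sublists k≤m) in sameSet⁺ _≟_ to from

    fibreN : List ℕ → List (List ℕ)
    fibreN T = fibre _≟L_ (headValues N) T (Ilist h S N)

    ∈fibreN⁻ : ∀ {T π} → π ∈ fibreN T → headValues N π ≡ T
    ∈fibreN⁻ {T} π∈ = proj₂ (∈-filter⁻ (λ π → headValues N π ≟L T) {xs = Ilist h S N} π∈)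

    fibre-in-window : ∀ {k T} → Window k T → filter (window? k ∘ take m) (fibreN T) ≡ fibreN T
    fibre-in-window {k} {T} w = filter-all (window? k ∘ take m) {xs = fibreN T}
      (All.tabulate λ π∈ → proj₂ (window-transfer (∈fibreN⁻ π∈)) w)

    fibre-off-window : ∀ {k T} → ¬ Window k T → filter (window? k ∘ take m) (fibreN T) ≡ []
    fibre-off-window {k} {T} ¬w = filter-none (window? k ∘ take m) {xs = fibreN T}
      (All.tabulate λ π∈ → ¬w ∘ proj₁ (window-transfer (∈fibreN⁻ π∈)))

    windowCount : ℕ → List ℕ → ℤ
    windowCount k T = + length (filter (window? k ∘ take m) (fibreN T))

    windowCount-split : ∀ {k} → k ≤ m → ∀ {TA} → TA ∈ sublists A →
                        ∑[ TB ∈ sublists B ] windowCount k (TA ++ TB) ≡ φ (length TA + k)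
    windowCount-split {k} k≤m {TA} TA∈ =
      trans (∑-single (λ TB → windowCount k (TA ++ TB)) (sublists-unique (ascending⇒unique (range-ascending H m)))
                      (range∈sublists k≤m) off-window)
            on-window
      where
      off-window : ∀ {TB} → TB ∈ sublists B → TB ≢ range H k → windowCount k (TA ++ TB) ≡ 0ℤ
      off-window TB∈ TB≢ = cong (+_ ∘ length) (fibre-off-window (TB≢ ∘ window⇒range TA∈ TB∈))
      on-window : windowCount k (TA ++ range H k) ≡ φ (length TA + k)
      on-window = begin
        windowCount k (TA ++ range H k)                ≡⟨ cong (+_ ∘ length) (fibre-in-window (range⇒window k≤m TA∈)) ⟩
        + count N (TA ++ range H k)                    ≡⟨ cong +_ (count-standard (subst (λ xs → TA ++ range H k ∈ sublists xs) (sym I≡A++B)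
                                                                                     (++∈sublists A TA∈ (range∈sublists k≤m)))) ⟩
        + count N (range G (length (TA ++ range H k))) ≡⟨ cong (λ l → + count N (range G l))
                                                               (trans (length-++ TA) (cong (_+_ (length TA)) (length-range H k))) ⟩
        φ (length TA + k)                              ∎
        where open ≡-Reasoning

  aCoeff≡∑φ : ∀ {k} → k ≤ m → + aCoeff h S k ≡ ∑[ TA ∈ sublists A ] φ (length TA + k)
  aCoeff≡∑φ {k} k≤m = begin
    + aCoeff h S k
      ≡⟨⟩
    + length (filter C (Ilist h S N))
      ≡⟨ length≡∑fibres _≟L_ (headValues N) (filter C (Ilist h S N)) (sublists-unique (ascending⇒unique (interval-ascending G N)))
                         (λ {π} _ → filter∈sublists (_∈? take m π) (I N)) ⟩
    ∑[ T ∈ sublists (I N) ] + length (fibre _≟L_ (headValues N) T (filter C (Ilist h S N)))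
      ≡⟨ ∑-cong (sublists (I N)) (λ {T} _ → cong (+_ ∘ length) (filter-comm (λ π → headValues N π ≟L T) C (Ilist h S N))) ⟩
    ∑[ T ∈ sublists (I N) ] windowCount k T
      ≡⟨ cong (λ xs → ∑ (sublists xs) (windowCount k)) I≡A++B ⟩
    ∑[ T ∈ sublists (A ++ B) ] windowCount k T
      ≡⟨ ∑-sublists-++ A B (windowCount k) ⟩
    ∑[ TA ∈ sublists A ] ∑[ TB ∈ sublists B ] windowCount k (TA ++ TB)
      ≡⟨ ∑-cong (sublists A) (windowCount-split k≤m) ⟩
    ∑[ TA ∈ sublists A ] φ (length TA + k) ∎
    where
    open ≡-Reasoning
    C = window? k ∘ take m

  X : ℕ → ℤ
  X n = + n ℤ.- + H ℤ.+ + 1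

  rhs≡Φ : ∀ n → rhs h S n ≡ Φ 0 (X n ℤ.+ + length A)
  rhs≡Φ n = begin
    ∑[ k ∈ upTo (suc m) ] + aCoeff h S k ℤ.* binomℤ (X n) k
      ≡⟨ ∑-cong (upTo (suc m)) (λ {k} k∈ → trans (cong (ℤ._* binomℤ (X n) k) (aCoeff≡∑φ (≤-pred (∈-upTo⁻ k∈))))
                                                 (∑-*ʳ (sublists A) (λ TA → φ (length TA + k)) (binomℤ (X n) k))) ⟩
    ∑[ k ∈ upTo (suc m) ] ∑[ TA ∈ sublists A ] φ (length TA + k) ℤ.* binomℤ (X n) k
      ≡⟨ ∑-comm (upTo (suc m)) (sublists A) (λ k TA → φ (length TA + k) ℤ.* binomℤ (X n) k) ⟩
    ∑[ TA ∈ sublists A ] Φ (length TA) (X n)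
      ≡⟨ ∑-sublists-Φ A 0 (X n) ⟩
    Φ 0 (X n ℤ.+ + length A) ∎
    where open ≡-Reasoning

  X+length-A≡length-I : ∀ {n} → J ≤ n → X n ℤ.+ + length A ≡ 0ℤ ℤ.+ + length (I n)
  X+length-A≡length-I {n} J≤n = begin
    X n ℤ.+ + length A                    ≡⟨ cong (λ l → X n ℤ.+ + l) (length-range G (H ∸ G)) ⟩
    X n ℤ.+ + (H ∸ G)                     ≡⟨ cong (ℤ._+_ (X n)) (+[m∸n]≡+m-+n G≤H) ⟩
    X n ℤ.+ (+ H ℤ.- + G)                 ≡⟨ solve 3 (λ n h g → ((n :- h) :+ con (+ 1)) :+ (h :- g) := con 0ℤ :+ ((con (+ 1) :+ n) :- g)) refl (+ n) (+ H) (+ G) ⟩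
    0ℤ ℤ.+ (+ suc n ℤ.- + G)              ≡⟨ cong (ℤ._+_ 0ℤ) (+[m∸n]≡+m-+n (≤-trans G≤1+J (s≤s J≤n))) ⟨
    0ℤ ℤ.+ + (suc n ∸ G)                  ≡⟨ cong (λ l → 0ℤ ℤ.+ + l) (length-range G (suc n ∸ G)) ⟨
    0ℤ ℤ.+ + length (I n)                 ∎
    where
    open ≡-Reasoning
    open +-*-Solver
    +[m∸n]≡+m-+n : ∀ {a b} → b ≤ a → + (a ∸ b) ≡ + a ℤ.- + b
    +[m∸n]≡+m-+n {a} {b} b≤a = trans (sym (ℤP.⊖-≥ b≤a)) (sym (ℤP.m-n≡m⊖n a b))

open import Data.Integer as ℤ using (+_; 0ℤ)

theorem3p5 : (h : ℕ → ℕ) → WeaklyIncreasing h → AboveDiagonal h →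
    (S : List (ℕ × ℕ)) → S ≢ [] → Admissible h S →
    (n : ℕ) → jS S ≤ n → + Icount h S n ≡ rhs h S n
theorem3p5 h h-mono h-above S S≢[] adm n J≤n = begin
  + Icount h S n                ≡⟨ Icount≡Φ J≤n ⟩
  Φ 0 (0ℤ ℤ.+ + length (I n))   ≡⟨ cong (Φ 0) (X+length-A≡length-I J≤n) ⟨
  Φ 0 (X n ℤ.+ + length A)      ≡⟨ rhs≡Φ n ⟨
  rhs h S n                     ∎
  where
  open ≡-Reasoning
  open AdmissibleSet h h-mono h-above S S≢[] adm
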